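{- Let $d$ be any distance function on the edges of the complete graph on $V=\{1,\dots,n\}$, let $x$ be a Hamiltonian cycle, and let $\Pi^x$ be the matrix with $\pi_{i,j}=\pi_{\max}=1-\frac1n$ if $\{i,j\}\in x$ and $\pi_{i,j}=\pi_{\min}=\frac{1}{n(n-2)}$ otherwise ($i\neq j$). With probability $\Omega(1)$, the solution generated by one run of the edge-based random solution generation with distribution $\Pi^x$ has a cost not larger than that of $x$.
   Context: Hamiltonian cycles are represented by permutations $(i_1,\dots,i_n)$ of $V$; the cost is $f(s)=\sum_{j=1}^{n-1}d(\{i_j,i_{j+1}\})+d(\{i_n,i_1\})$. Edge-based random solution generation from a symmetric matrix $\Pi=(\pi_{i,j})$: start with $B=\emptyset$; at each step choose an edge $\{i,j\}$ among the admissible edges (edges not in $B$ such that $(V,B\cup\{\{i,j\}\})$ has no vertex of degree $\ge3$ and no cycle, except that the final edge closing the Hamiltonian path into a Hamiltonian cycle is allowed) with probability $(\pi_{i,j}+\pi_{j,i})/\sum_{\{k,l\}\text{ admissible}}(\pi_{k,l}+\pi_{l,k})$ and add it to $B$; stop when $B$ is a Hamiltonian cycle. Asymptotic notation refers to $n\to\infty$.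
   Formalization: The distance function d takes rational values rather than real ones. -}

module Defs where

open import Data.Nat as ℕ using (ℕ; zero; suc; _∸_; _≤_)
open import Data.Fin as Fin using (Fin; toℕ; fromℕ<)
open import Data.Fin.Properties using (any?) renaming (_≟_ to _≟ᶠ_)
open import Data.Fin.Permutation using (Permutation′; _⟨$⟩ʳ_)
open import Data.Integer using (+_)
open import Data.Rational as ℚ using (ℚ; 0ℚ; 1ℚ; _+_; _*_; _-_; _÷_; _/_; ≢-nonZero)
open import Data.Rational.Properties using () renaming (_≟_ to _≟ℚ_; _≤?_ to _≤ℚ?_)
open import Data.List using (List; []; _∷_; _++_; map; filter; length; foldr; take; cartesianProduct; allFin)
open import Data.List.Membership.Propositional using (_∈_; _∉_)
open import Data.List.Relation.Unary.All using (All)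
open import Data.List.Relation.Unary.Unique.Propositional using (Unique)
open import Data.List.Relation.Binary.Permutation.Propositional using (_↭_)
open import Data.Product using (Σ; Σ-syntax; ∃; _×_; _,_; proj₁; proj₂)
open import Data.Sum using (_⊎_)
open import Data.Unit using (⊤)
open import Function.Bundles using (_⇔_)
open import Relation.Binary.PropositionalEquality using (_≡_)
open import Relation.Nullary using (Dec; yes; no; ¬_; _×-dec_; _⊎-dec_; ¬?)
import Data.Product.Properties

-- Edges of K_n are stored as ordered pairs (i , j); the list of all edges
-- of K_n uses the representative with toℕ i < toℕ j.
Edge : ℕ → Set
Edge n = Fin n × Fin n

Σℚ : List ℚ → ℚ
Σℚ = foldr _+_ 0ℚ

-- 1/m as a rational (with the junk value 0 for m = 0, never used for n ≥ 3)
recipℕ : ℕ → ℚ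
recipℕ zero    = 0ℚ
recipℕ (suc m) = + 1 / suc m

-- p / q, with junk value 0 when q = 0 (only happens if no edge is admissible)
divℚ : ℚ → ℚ → ℚ
divℚ p q with q ≟ℚ 0ℚ
... | yes _  = 0ℚ
... | no q≢0 = _÷_ p q {{≢-nonZero q≢0}}

next : ∀ {n} → Fin n → Fin n
next {suc m} k with suc (toℕ k) ℕ.<? suc m
... | yes p = fromℕ< p
... | no _  = Fin.zero

Adj : ∀ {n} → List (Edge n) → Fin n → Fin n → Set
Adj G u v = ((u , v) ∈ G) ⊎ ((v , u) ∈ G)

pairs : ∀ {n} → List (Fin n) → List (Edge n)
pairs (a ∷ b ∷ rest) = (a , b) ∷ pairs (b ∷ rest)
pairs _              = []

cycEdges : ∀ {n} → List (Fin n) → List (Edge n)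
cycEdges vs = pairs (vs ++ take 1 vs)

HasCycle : ∀ {n} → List (Edge n) → Set
HasCycle G = Σ[ vs ∈ List _ ] (3 ≤ length vs × Unique vs
             × All (λ e → Adj G (proj₁ e) (proj₂ e)) (cycEdges vs))

IsHamCycle : ∀ {n} → List (Edge n) → Set
IsHamCycle {n} G = Σ[ vs ∈ List (Fin n) ] (vs ↭ allFin n
             × (∀ u v → Adj G u v ⇔ Adj (cycEdges vs) u v))

deg : ∀ {n} → List (Edge n) → Fin n → ℕ
deg G v = length (filter (λ e → (proj₁ e ≟ᶠ v) ⊎-dec (proj₂ e ≟ᶠ v)) G)

-- The matrix Π^x for a Hamiltonian cycle x given as a permutation σ
-- (x = (σ 0, σ 1, …, σ (n-1)))

InCycle : ∀ {n} → Permutation′ n → Fin n → Fin n → Set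
InCycle σ i j = ∃ λ k → ((i ≡ σ ⟨$⟩ʳ k) × (j ≡ σ ⟨$⟩ʳ next k))
                       ⊎ ((j ≡ σ ⟨$⟩ʳ k) × (i ≡ σ ⟨$⟩ʳ next k))

inCycle? : ∀ {n} (σ : Permutation′ n) i j → Dec (InCycle σ i j)
inCycle? σ i j = any? λ k →
  ((i ≟ᶠ σ ⟨$⟩ʳ k) ×-dec (j ≟ᶠ σ ⟨$⟩ʳ next k))
  ⊎-dec ((j ≟ᶠ σ ⟨$⟩ʳ k) ×-dec (i ≟ᶠ σ ⟨$⟩ʳ next k))

πmax πmin : ℕ → ℚ
πmax n = 1ℚ - recipℕ n
πmin n = recipℕ (n ℕ.* (n ∸ 2))

-- π_{i,j} of Π^x (i ≠ j; the diagonal is never used)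
πx : ∀ {n} → Permutation′ n → Fin n → Fin n → ℚ
πx {n} σ i j with inCycle? σ i j
... | yes _ = πmax n
... | no _  = πmin n

tourCost : ∀ {n} → (Fin n → Fin n → ℚ) → Permutation′ n → ℚ
tourCost {n} d σ = Σℚ (map (λ k → d (σ ⟨$⟩ʳ k) (σ ⟨$⟩ʳ next k)) (allFin n))

edgeCost : ∀ {n} → (Fin n → Fin n → ℚ) → List (Edge n) → ℚ
edgeCost d B = Σℚ (map (λ e → d (proj₁ e) (proj₂ e)) B)

-- The process is parametrised by
-- (arbitrary) decision procedures for HasCycle and IsHamCycle; since these
-- are propositions about finite objects, any two decision procedures give
-- the same answers, so the resulting probability does not depend on them.

module Generation (n : ℕ)
  (cyc? : (G : List (Edge n)) → Dec (HasCycle G))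
  (ham? : (G : List (Edge n)) → Dec (IsHamCycle G)) where

  open import Data.List.Membership.DecPropositional
    (Data.Product.Properties.≡-dec (_≟ᶠ_ {n}) (_≟ᶠ_ {n})) using (_∉?_)
  open import Data.Fin.Properties using (all?)

  allEdges : List (Edge n)
  allEdges = filter (λ e → toℕ (proj₁ e) ℕ.<? toℕ (proj₂ e))
                    (cartesianProduct (allFin n) (allFin n))

  Admissible : List (Edge n) → Edge n → Set
  Admissible B e = (e ∉ B) × (∀ v → deg (e ∷ B) v ≤ 2)
                   × (¬ HasCycle (e ∷ B) ⊎ IsHamCycle (e ∷ B))

  admissible? : ∀ B e → Dec (Admissible B e)
  admissible? B e = (e ∉? B) ×-dec (all? {n} (λ v → deg (e ∷ B) v ℕ.≤? 2))
                    ×-dec (¬? (cyc? (e ∷ B)) ⊎-dec ham? (e ∷ B))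

  module _ (σ : Permutation′ n) (d : Fin n → Fin n → ℚ) where

    w : Edge n → ℚ
    w e = πx σ (proj₁ e) (proj₂ e) + πx σ (proj₂ e) (proj₁ e)

    event : List (Edge n) → ℚ
    event B with edgeCost d B ≤ℚ? tourCost d σ
    ... | yes _ = 1ℚ
    ... | no _  = 0ℚ

    -- probability of the event, starting from current edge set B with
    -- at most k further steps
    probFrom : ℕ → List (Edge n) → ℚ
    probFrom k B with ham? B
    ... | yes _ = event B
    probFrom zero B    | no _ = 0ℚ
    probFrom (suc k) B | no _ =
      let A = filter (admissible? B) allEdges
          W = Σℚ (map w A)
      in Σℚ (map (λ e → divℚ (w e) W * probFrom k (e ∷ B)) A)

    -- probability that one run (from B = ∅; n steps suffice) produces a
    -- solution of cost ≤ f(x)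
    successProb : ℚ
    successProb = probFrom n []

-- Bound the success probability from below by the probability that every chosen edge lies on x:
-- such a run ends with B = x, whose cost is f(x).  While B ⊆ x misses m edges, all of them are
-- admissible and have weight α = 2 πmax, whereas an admissible edge off x joins two vertices of
-- degree ≤ 1 in B.  Every such vertex is an endpoint of a missing edge, so there are
-- b ≤ min((2m)², n²) admissible edges off x, each of weight β = α / D with D = (n - 1) (n - 2).
-- Hence the next edge lies on x with probability at least D m / (D m + b).  While m ≤ n/4
-- these factors keep the product above about 1/2; beyond that they are at least m / (m + 2) and
-- telescope, leaving a constant fraction, at least 1/64 once n ≥ 11.

module Submission where

open import Defs using (Edge; HasCycle; IsHamCycle)
open import Data.Nat using (ℕ; suc)
open import Data.Fin using (Fin)
open import Data.Fin.Permutation using (Permutation′)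
open import Data.List using (List)
open import Data.Rational using (ℚ)
open import Relation.Nullary using (Dec)
open import Relation.Binary.PropositionalEquality using (_≡_)

module CyclicSuccessor (k : ℕ) where

  open import Defs using (next)
  open import Data.Nat using (ℕ; zero; suc; _+_; _∸_; _%_; _≤_; _<_; _<?_; s≤s; z≤n)
  open import Data.Nat.Properties
  open import Data.Nat.DivMod
  open import Data.Fin using (Fin; toℕ)
  open import Data.Fin.Properties using (toℕ-injective; toℕ<n; toℕ-fromℕ<)
  open import Data.Product using (∃; _×_; _,_)
  open import Data.Empty using (⊥-elim)
  open import Relation.Nullary using (yes; no)
  open import Relation.Binary.PropositionalEquality
  open ≡-Reasoning

  n : ℕ
  n = suc (suc (suc k))

  next^ : ℕ → Fin n → Fin n
  next^ zero    p = p
  next^ (suc j) p = next (next^ j p)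

  toℕ-next : (p : Fin n) → toℕ (next p) ≡ suc (toℕ p) % n
  toℕ-next p with suc (toℕ p) <? n
  ... | yes lt = trans (toℕ-fromℕ< lt) (sym (m<n⇒m%n≡m lt))
  ... | no ¬lt = sym (trans (cong (_% n) (≤-antisym (toℕ<n p) (≮⇒≥ ¬lt))) (n%n≡0 n))

  [a+b%n]%n≡[a+b]%n : ∀ a b → (a + b % n) % n ≡ (a + b) % n
  [a+b%n]%n≡[a+b]%n a b = begin
    (a + b % n) % n          ≡⟨ %-distribˡ-+ a (b % n) n ⟩
    (a % n + b % n % n) % n  ≡⟨ cong (λ z → (a % n + z) % n) (m%n%n≡m%n b n) ⟩
    (a % n + b % n) % n      ≡⟨ %-distribˡ-+ a b n ⟨
    (a + b) % n              ∎

  toℕ-next^ : ∀ j p → toℕ (next^ j p) ≡ (toℕ p + j) % n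
  toℕ-next^ zero p = begin
    toℕ p             ≡⟨ m<n⇒m%n≡m (toℕ<n p) ⟨
    toℕ p % n         ≡⟨ cong (_% n) (+-identityʳ (toℕ p)) ⟨
    (toℕ p + 0) % n   ∎
  toℕ-next^ (suc j) p = begin
    toℕ (next (next^ j p))      ≡⟨ toℕ-next (next^ j p) ⟩
    suc (toℕ (next^ j p)) % n   ≡⟨ cong (λ z → suc z % n) (toℕ-next^ j p) ⟩
    suc ((toℕ p + j) % n) % n   ≡⟨ [a+b%n]%n≡[a+b]%n 1 (toℕ p + j) ⟩
    suc (toℕ p + j) % n         ≡⟨ cong (_% n) (+-suc (toℕ p) j) ⟨
    (toℕ p + suc j) % n         ∎

  next^-next : ∀ j p → next^ j (next p) ≡ next (next^ j p)
  next^-next zero    p = refl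
  next^-next (suc j) p = cong next (next^-next j p)

  next^n≡id : ∀ p → next^ n p ≡ p
  next^n≡id p = toℕ-injective (begin
    toℕ (next^ n p)    ≡⟨ toℕ-next^ n p ⟩
    (toℕ p + n) % n    ≡⟨ [m+n]%n≡m%n (toℕ p) n ⟩
    toℕ p % n          ≡⟨ m<n⇒m%n≡m (toℕ<n p) ⟩
    toℕ p              ∎)

  [p+j]%n≢p : ∀ p j → p < n → 0 < j → j < n → (p + j) % n ≢ p
  [p+j]%n≢p p j p<n 0<j j<n eq with p + j <? n
  ... | yes lt = <-irrefl (sym (trans (sym (m<n⇒m%n≡m lt)) eq)) (m<m+n p 0<j)
  ... | no ¬lt = <-irrefl j≡n j<n
    where
    n≤p+j : n ≤ p + j
    n≤p+j = ≮⇒≥ ¬lt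
    p+j∸n<n : p + j ∸ n < n
    p+j∸n<n = +-cancelʳ-< n (p + j ∸ n) n
      (subst (_< n + n) (sym (m∸n+n≡m n≤p+j)) (+-mono-< p<n j<n))
    p+j∸n≡p : p + j ∸ n ≡ p
    p+j∸n≡p = trans (sym (m<n⇒m%n≡m p+j∸n<n)) (trans (m≤n⇒[n∸m]%m≡n%m n≤p+j) eq)
    j≡n : j ≡ n
    j≡n = +-cancelˡ-≡ p j n (trans (sym (m∸n+n≡m n≤p+j)) (cong (_+ n) p+j∸n≡p))

  next^-period : ∀ j p → next^ j p ≡ p → 0 < j → n ≤ j
  next^-period j p eq 0<j with j <? n
  ... | no ¬lt = ≮⇒≥ ¬lt
  ... | yes lt = ⊥-elim ([p+j]%n≢p (toℕ p) j (toℕ<n p) 0<j lt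
                           (trans (sym (toℕ-next^ j p)) (cong toℕ eq)))

  next^-reaches : ∀ p q → ∃ λ j → j < n × next^ j p ≡ q
  next^-reaches p q = j , m%n<n (toℕ q + (n ∸ toℕ p)) n , toℕ-injective (begin
      toℕ (next^ j p)                        ≡⟨ toℕ-next^ j p ⟩
      (toℕ p + j) % n                        ≡⟨ [a+b%n]%n≡[a+b]%n (toℕ p) _ ⟩
      (toℕ p + (toℕ q + (n ∸ toℕ p))) % n    ≡⟨ cong (_% n) rearrange ⟩
      (toℕ q + n) % n                        ≡⟨ [m+n]%n≡m%n (toℕ q) n ⟩
      toℕ q % n                              ≡⟨ m<n⇒m%n≡m (toℕ<n q) ⟩
      toℕ q                                  ∎)
    where
    j = (toℕ q + (n ∸ toℕ p)) % n
    rearrange : toℕ p + (toℕ q + (n ∸ toℕ p)) ≡ toℕ q + n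
    rearrange = begin
      toℕ p + (toℕ q + (n ∸ toℕ p))  ≡⟨ +-comm (toℕ p) _ ⟩
      toℕ q + (n ∸ toℕ p) + toℕ p    ≡⟨ +-assoc (toℕ q) _ _ ⟩
      toℕ q + (n ∸ toℕ p + toℕ p)    ≡⟨ cong (toℕ q +_) (m∸n+n≡m (<⇒≤ (toℕ<n p))) ⟩
      toℕ q + n                      ∎

  prev : Fin n → Fin n
  prev = next^ (suc (suc k))

  next-prev : ∀ p → next (prev p) ≡ p
  next-prev = next^n≡id

  next-injective : ∀ {a b} → next a ≡ next b → a ≡ b
  next-injective {a} {b} eq = begin
    a                    ≡⟨ next^n≡id a ⟨
    next (prev a)        ≡⟨ next^-next (suc (suc k)) a ⟨
    prev (next a)        ≡⟨ cong prev eq ⟩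
    prev (next b)        ≡⟨ next^-next (suc (suc k)) b ⟩
    next (prev b)        ≡⟨ next^n≡id b ⟩
    b                    ∎

  prev-next : ∀ p → prev (next p) ≡ p
  prev-next p = next-injective (next-prev (next p))

  next≢id : ∀ p → next p ≢ p
  next≢id p eq with next^-period 1 p eq (s≤s z≤n)
  ... | s≤s ()

  next²≢id : ∀ p → next (next p) ≢ p
  next²≢id p eq with next^-period 2 p eq (s≤s z≤n)
  ... | s≤s (s≤s ())

module UniqueCounting where

  open import Data.Nat using (suc; _+_; _*_; _≤_; _<_; s≤s; z≤n)
  open import Data.Nat.Properties using (<-irrefl; <-≤-trans)
  open import Data.List using (List; []; _∷_; _++_; map; length; cartesianProduct)
  open import Data.List.Properties using (length-++; length-map)
  open import Data.List.Membership.Propositional using (_∈_; _∉_)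
  open import Data.List.Membership.Propositional.Properties using (∈-∃++)
  open import Data.List.Relation.Binary.Subset.Propositional using (_⊆_)
  open import Data.List.Relation.Unary.Any using (here; there)
  open import Data.List.Relation.Unary.AllPairs using (_∷_)
  open import Data.List.Relation.Unary.Unique.Propositional using (Unique)
  open import Data.List.Relation.Unary.Unique.Propositional.Properties using (Unique[x∷xs]⇒x∉xs)
  open import Data.List.Relation.Binary.Permutation.Propositional using (_↭_; ↭⇒↭ₛ′)
  import Data.List.Relation.Binary.Permutation.Setoid.Properties as PermutationSetoid
  open import Data.Product using (_,_)
  open import Data.Empty using (⊥-elim)
  open import Relation.Nullary using (yes; no)
  open import Relation.Binary.Definitions using (DecidableEquality)
  open import Relation.Binary.PropositionalEquality
    using (_≡_; _≢_; refl; cong; cong₂; sym; trans; subst; setoid; isEquivalence)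

  private variable
    A B : Set

  private
    ∈-remove : ∀ {x y : A} as bs → x ∈ as ++ y ∷ bs → x ≢ y → x ∈ as ++ bs
    ∈-remove []       bs (here x≡y) x≢y = ⊥-elim (x≢y x≡y)
    ∈-remove []       bs (there x∈) x≢y = x∈
    ∈-remove (a ∷ as) bs (here x≡a) x≢y = here x≡a
    ∈-remove (a ∷ as) bs (there x∈) x≢y = there (∈-remove as bs x∈ x≢y)

    length-remove : ∀ (as : List A) y bs → length (as ++ y ∷ bs) ≡ suc (length (as ++ bs))
    length-remove []       y bs = refl
    length-remove (a ∷ as) y bs = cong suc (length-remove as y bs)

  Unique⇒length-≤ : ∀ {xs ys : List A} → Unique xs → xs ⊆ ys → length xs ≤ length ys
  Unique⇒length-≤ {xs = []}     _          _   = z≤n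
  Unique⇒length-≤ {xs = x ∷ xs} u@(_ ∷ u′) x∷xs⊆ys with ∈-∃++ (x∷xs⊆ys (here refl))
  ... | as , bs , refl = subst (suc (length xs) ≤_) (sym (length-remove as x bs))
      (s≤s (Unique⇒length-≤ u′ λ {z} z∈xs → ∈-remove as bs (x∷xs⊆ys (there z∈xs))
        λ z≡x → Unique[x∷xs]⇒x∉xs u (subst (_∈ xs) z≡x z∈xs)))

  Unique⇒length-< : ∀ {xs ys : List A} {y} → Unique xs → xs ⊆ ys → y ∈ ys → y ∉ xs →
                    length xs < length ys
  Unique⇒length-< {xs = xs} {y = y} u xs⊆ys y∈ys y∉xs with ∈-∃++ y∈ys
  ... | as , bs , refl = subst (suc (length xs) ≤_) (sym (length-remove as y bs))
      (s≤s (Unique⇒length-≤ u λ {z} z∈xs → ∈-remove as bs (xs⊆ys z∈xs)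
        λ z≡y → y∉xs (subst (_∈ xs) z≡y z∈xs)))

  module _ (_≟_ : DecidableEquality A) where
    open import Data.List.Membership.DecPropositional _≟_ using (_∈?_)

    Unique∧⊆∧length-≥⇒⊇ : ∀ {xs ys : List A} → Unique xs → xs ⊆ ys →
                          length ys ≤ length xs → ys ⊆ xs
    Unique∧⊆∧length-≥⇒⊇ {xs} u xs⊆ys ys≤xs {y} y∈ys with y ∈? xs
    ... | yes y∈xs = y∈xs
    ... | no  y∉xs = ⊥-elim (<-irrefl refl (<-≤-trans (Unique⇒length-< u xs⊆ys y∈ys y∉xs) ys≤xs))

  Unique-resp-↭ : ∀ {xs ys : List A} → xs ↭ ys → Unique xs → Unique ys
  Unique-resp-↭ {A} p = PermutationSetoid.Unique-resp-↭ (setoid A) (↭⇒↭ₛ′ isEquivalence p)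

  length-cartesianProduct : ∀ (xs : List A) (ys : List B) →
                            length (cartesianProduct xs ys) ≡ length xs * length ys
  length-cartesianProduct []       ys = refl
  length-cartesianProduct (x ∷ xs) ys = trans (length-++ (map (x ,_) ys))
    (cong₂ _+_ (length-map (x ,_) ys) (length-cartesianProduct xs ys))

module RationalArithmetic where

  open import Defs using (recipℕ; divℚ)
  open import Data.Nat as ℕ using (ℕ; zero; suc)
  import Data.Nat.Properties as ℕ
  open import Data.Integer as ℤ using (ℤ)
  open import Data.Integer.Tactic.RingSolver using (solve-∀)
  open import Data.Rational using (ℚ; 0ℚ; 1ℚ; _+_; _*_; _≤_; _<_; toℚᵘ; 1/_; nonNegative; positive; ≢-nonZero)
  open import Data.Rational.Properties
  open import Data.Rational.Unnormalised using (mkℚᵘ; *≡*) renaming (_≃_ to _≃ᵘ_)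
  import Data.Rational.Unnormalised.Properties as ℚᵘ
  open import Data.Rational.Solver using (module +-*-Solver)
  open +-*-Solver
  open import Data.Product using (_,_)
  open import Data.Empty using (⊥-elim)
  open import Relation.Nullary using (yes; no)
  open import Relation.Binary.Definitions using (tri<; tri≈; tri>)
  open import Relation.Binary.PropositionalEquality using (_≡_; refl; cong; sym; trans; subst)

  fromℕ : ℕ → ℚ
  fromℕ zero    = 0ℚ
  fromℕ (suc m) = 1ℚ + fromℕ m

  toℚᵘ-fromℕ : ∀ m → toℚᵘ (fromℕ m) ≃ᵘ mkℚᵘ (ℤ.+ m) 0
  toℚᵘ-fromℕ zero    = *≡* refl
  toℚᵘ-fromℕ (suc m) = ℚᵘ.≃-trans (toℚᵘ-homo-+ 1ℚ (fromℕ m))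
    (ℚᵘ.≃-trans (ℚᵘ.+-cong (ℚᵘ.≃-refl {mkℚᵘ (ℤ.1ℤ) 0}) (toℚᵘ-fromℕ m)) (*≡* (identity (ℤ.+ m))))
    where
    identity : ∀ (x : ℤ) → (ℤ.1ℤ ℤ.* ℤ.1ℤ ℤ.+ x ℤ.* ℤ.1ℤ) ℤ.* ℤ.1ℤ ≡ (ℤ.1ℤ ℤ.+ x) ℤ.* (ℤ.1ℤ ℤ.* ℤ.1ℤ)
    identity = solve-∀

  fromℕ*recipℕ≡1 : ∀ m → fromℕ (suc m) * recipℕ (suc m) ≡ 1ℚ
  fromℕ*recipℕ≡1 m = toℚᵘ-injective (ℚᵘ.≃-trans (toℚᵘ-homo-* (fromℕ (suc m)) (recipℕ (suc m)))
    (ℚᵘ.≃-trans (ℚᵘ.*-cong (toℚᵘ-fromℕ (suc m)) (toℚᵘ-fromℚᵘ (mkℚᵘ (ℤ.1ℤ) m))) (*≡* (identity (ℤ.+ m)))))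
    where
    identity : ∀ (x : ℤ) → ((ℤ.1ℤ ℤ.+ x) ℤ.* ℤ.1ℤ) ℤ.* ℤ.1ℤ ≡ ℤ.1ℤ ℤ.* (ℤ.1ℤ ℤ.* (ℤ.1ℤ ℤ.+ x))
    identity = solve-∀

  fromℕ-+ : ∀ a b → fromℕ (a ℕ.+ b) ≡ fromℕ a + fromℕ b
  fromℕ-+ zero    b = sym (+-identityˡ (fromℕ b))
  fromℕ-+ (suc a) b = trans (cong (1ℚ +_) (fromℕ-+ a b)) (sym (+-assoc 1ℚ (fromℕ a) (fromℕ b)))

  fromℕ-* : ∀ a b → fromℕ (a ℕ.* b) ≡ fromℕ a * fromℕ b
  fromℕ-* zero    b = sym (*-zeroˡ (fromℕ b))
  fromℕ-* (suc a) b = trans (fromℕ-+ b (a ℕ.* b))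
    (trans (cong (fromℕ b +_) (fromℕ-* a b)) (identity (fromℕ a) (fromℕ b)))
    where
    identity : ∀ x y → y + x * y ≡ (1ℚ + x) * y
    identity = solve 2 (λ x y → y :+ x :* y := (con 1ℚ :+ x) :* y) refl

  0≤+ : ∀ {p q} → 0ℚ ≤ p → 0ℚ ≤ q → 0ℚ ≤ p + q
  0≤+ = +-mono-≤

  *-monoˡ-≤-0≤ : ∀ {r p q} → 0ℚ ≤ r → p ≤ q → r * p ≤ r * q
  *-monoˡ-≤-0≤ {r} 0≤r = *-monoˡ-≤-nonNeg r {{nonNegative 0≤r}}

  *-monoʳ-≤-0≤ : ∀ {r p q} → 0ℚ ≤ r → p ≤ q → p * r ≤ q * r
  *-monoʳ-≤-0≤ {r} 0≤r = *-monoʳ-≤-nonNeg r {{nonNegative 0≤r}}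

  0≤* : ∀ {p q} → 0ℚ ≤ p → 0ℚ ≤ q → 0ℚ ≤ p * q
  0≤* {p} 0≤p 0≤q = subst (_≤ p * _) (*-zeroʳ p) (*-monoˡ-≤-0≤ 0≤p 0≤q)

  0<* : ∀ {p q} → 0ℚ < p → 0ℚ < q → 0ℚ < p * q
  0<* {p} {q} 0<p 0<q = positive⁻¹ _ {{pos*pos⇒pos p {{positive 0<p}} q {{positive 0<q}}}}

  *-cancelʳ-≤-0< : ∀ {r p q} → 0ℚ < r → p * r ≤ q * r → p ≤ q
  *-cancelʳ-≤-0< {r} 0<r = *-cancelʳ-≤-pos r {{positive 0<r}}

  0≤recipℕ : ∀ m → 0ℚ ≤ recipℕ m
  0≤recipℕ zero    = ≤-refl
  0≤recipℕ (suc m) = nonNegative⁻¹ _ {{normalize-nonNeg 1 (suc m)}}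

  0≤fromℕ : ∀ a → 0ℚ ≤ fromℕ a
  0≤fromℕ zero    = ≤-refl
  0≤fromℕ (suc a) = 0≤+ (nonNegative⁻¹ 1ℚ) (0≤fromℕ a)

  0<fromℕ : ∀ a → 0ℚ < fromℕ (suc a)
  0<fromℕ a = <-≤-trans (positive⁻¹ 1ℚ)
    (subst (_≤ 1ℚ + fromℕ a) (+-identityʳ 1ℚ) (+-monoʳ-≤ 1ℚ (0≤fromℕ a)))

  fromℕ-mono-≤ : ∀ {a b} → a ℕ.≤ b → fromℕ a ≤ fromℕ b
  fromℕ-mono-≤ {a} a≤b with ℕ.m≤n⇒∃[o]m+o≡n a≤b
  ... | o , refl = subst (_≤ fromℕ (a ℕ.+ o)) (+-identityʳ (fromℕ a))
      (subst (fromℕ a + 0ℚ ≤_) (sym (fromℕ-+ a o)) (+-monoʳ-≤ (fromℕ a) (0≤fromℕ o)))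

  divℚ-nonZero : ∀ p q → 0ℚ < q → divℚ p q ≡ p * divℚ 1ℚ q
  divℚ-nonZero p q 0<q with q ≟ 0ℚ
  ... | yes q≡0 = ⊥-elim (<-irrefl (sym q≡0) 0<q)
  ... | no  _   = cong (p *_) (sym (*-identityˡ _))

  *-divℚ-inverse : ∀ q → 0ℚ < q → q * divℚ 1ℚ q ≡ 1ℚ
  *-divℚ-inverse q 0<q with q ≟ 0ℚ
  ... | yes q≡0 = ⊥-elim (<-irrefl (sym q≡0) 0<q)
  ... | no  q≢0 = trans (cong (q *_) (*-identityˡ _)) (*-inverseʳ q {{≢-nonZero q≢0}})

  0≤divℚ : ∀ p q → 0ℚ ≤ p → 0ℚ ≤ q → 0ℚ ≤ divℚ p q
  0≤divℚ p q 0≤p 0≤q with q ≟ 0ℚ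
  ... | yes _   = ≤-refl
  ... | no  q≢0 = 0≤* 0≤p (nonNegative⁻¹ 1/q {{pos⇒nonNeg 1/q {{1/pos⇒pos q {{positive 0<q}}}}}})
    where
    1/q = (1/ q) {{≢-nonZero q≢0}}
    0<q : 0ℚ < q
    0<q with <-cmp 0ℚ q
    ... | tri< 0<q _ _ = 0<q
    ... | tri≈ _ 0≡q _ = ⊥-elim (q≢0 (sym 0≡q))
    ... | tri> _ _ q<0 = ⊥-elim (<-irrefl refl (<-≤-trans q<0 0≤q))

  infix 8 _/1+_

  _/1+_ : ℕ → ℕ → ℚ
  u /1+ v = fromℕ u * recipℕ (suc v)

  /1+-*-cancel : ∀ u v → u /1+ v * fromℕ (suc v) ≡ fromℕ u
  /1+-*-cancel u v = trans (*-assoc (fromℕ u) _ _)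
    (trans (cong (fromℕ u *_) (trans (*-comm (recipℕ (suc v)) _) (fromℕ*recipℕ≡1 v))) (*-identityʳ (fromℕ u)))

  /1+-mono-≤ : ∀ u v u′ v′ → u ℕ.* suc v′ ℕ.≤ u′ ℕ.* suc v → u /1+ v ≤ u′ /1+ v′
  /1+-mono-≤ u v u′ v′ cross = *-cancelʳ-≤-0< (0<* (0<fromℕ v) (0<fromℕ v′)) (begin
      u /1+ v * (fromℕ (suc v) * fromℕ (suc v′))     ≡⟨ *-assoc (u /1+ v) _ _ ⟨
      u /1+ v * fromℕ (suc v) * fromℕ (suc v′)       ≡⟨ cong (_* fromℕ (suc v′)) (/1+-*-cancel u v) ⟩
      fromℕ u * fromℕ (suc v′)                       ≡⟨ fromℕ-* u (suc v′) ⟨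
      fromℕ (u ℕ.* suc v′)                           ≤⟨ fromℕ-mono-≤ cross ⟩
      fromℕ (u′ ℕ.* suc v)                           ≡⟨ fromℕ-* u′ (suc v) ⟩
      fromℕ u′ * fromℕ (suc v)                       ≡⟨ cong (_* fromℕ (suc v)) (/1+-*-cancel u′ v′) ⟨
      u′ /1+ v′ * fromℕ (suc v′) * fromℕ (suc v)     ≡⟨ *-assoc (u′ /1+ v′) _ _ ⟩
      u′ /1+ v′ * (fromℕ (suc v′) * fromℕ (suc v))   ≡⟨ cong (u′ /1+ v′ *_) (*-comm (fromℕ (suc v′)) _) ⟩
      u′ /1+ v′ * (fromℕ (suc v) * fromℕ (suc v′))   ∎)
    where open ≤-Reasoning

module RationalSums where

  open import Defs using (Σℚ)
  open RationalArithmetic using (fromℕ; 0≤+)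
  open import Data.Rational using (ℚ; 0ℚ; 1ℚ; _+_; _*_; _≤_)
  open import Data.Rational.Properties
  open import Data.Rational.Solver using (module +-*-Solver)
  open +-*-Solver
  open import Data.List using ([]; _∷_; map; filter; length)
  open import Data.List.Membership.Propositional using (_∈_)
  open import Data.List.Relation.Unary.Any using (here; there)
  open import Data.List.Relation.Binary.Permutation.Propositional using (_↭_; refl; prep; swap; trans)
  open import Relation.Nullary using (yes; no)
  open import Relation.Unary using (Pred; Decidable)
  open import Relation.Unary.Properties using (∁?)
  open import Relation.Binary.PropositionalEquality as ≡ using (_≡_; cong; cong₂; sym)
  open import Function using (_∘_)
  open import Level using (0ℓ)

  private variable
    A : Set

  private
    +-exchange : ∀ a b c → a + (b + c) ≡ b + (a + c)
    +-exchange = solve 3 (λ a b c → a :+ (b :+ c) := b :+ (a :+ c)) ≡.refl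

  Σℚ-partition : ∀ (f : A → ℚ) {P : Pred A 0ℓ} (P? : Decidable P) xs →
    Σℚ (map f xs) ≡ Σℚ (map f (filter P? xs)) + Σℚ (map f (filter (∁? P?) xs))
  Σℚ-partition f P? []       = ≡.refl
  Σℚ-partition f P? (x ∷ xs) with P? x
  ... | yes _ = ≡.trans (cong (f x +_) (Σℚ-partition f P? xs)) (sym (+-assoc (f x) _ _))
  ... | no  _ = ≡.trans (cong (f x +_) (Σℚ-partition f P? xs))
      (+-exchange (f x) (Σℚ (map f (filter P? xs))) _)

  0≤Σℚ : ∀ (f : A → ℚ) xs → (∀ {x} → x ∈ xs → 0ℚ ≤ f x) → 0ℚ ≤ Σℚ (map f xs)
  0≤Σℚ f []       _   = ≤-refl
  0≤Σℚ f (x ∷ xs) 0≤f = 0≤+ (0≤f (here ≡.refl)) (0≤Σℚ f xs (0≤f ∘ there))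

  Σℚ-mono-≤ : ∀ (f g : A → ℚ) xs → (∀ {x} → x ∈ xs → f x ≤ g x) → Σℚ (map f xs) ≤ Σℚ (map g xs)
  Σℚ-mono-≤ f g []       _   = ≤-refl
  Σℚ-mono-≤ f g (x ∷ xs) f≤g = +-mono-≤ (f≤g (here ≡.refl)) (Σℚ-mono-≤ f g xs (f≤g ∘ there))

  Σℚ-cong : ∀ (f g : A → ℚ) xs → (∀ {x} → x ∈ xs → f x ≡ g x) → Σℚ (map f xs) ≡ Σℚ (map g xs)
  Σℚ-cong f g []       _   = ≡.refl
  Σℚ-cong f g (x ∷ xs) f≡g = cong₂ _+_ (f≡g (here ≡.refl)) (Σℚ-cong f g xs (f≡g ∘ there))

  Σℚ-const : ∀ (f : A → ℚ) c xs → (∀ {x} → x ∈ xs → f x ≡ c) → Σℚ (map f xs) ≡ fromℕ (length xs) * c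
  Σℚ-const f c []       _   = sym (*-zeroˡ c)
  Σℚ-const f c (x ∷ xs) f≡c = ≡.trans (cong₂ _+_ (f≡c (here ≡.refl)) (Σℚ-const f c xs (f≡c ∘ there)))
    (identity c (fromℕ (length xs)))
    where
    identity : ∀ c l → c + l * c ≡ (1ℚ + l) * c
    identity = solve 2 (λ c l → c :+ l :* c := (con 1ℚ :+ l) :* c) ≡.refl

  Σℚ-*ʳ : ∀ (f : A → ℚ) c xs → Σℚ (map (λ x → f x * c) xs) ≡ Σℚ (map f xs) * c
  Σℚ-*ʳ f c []       = sym (*-zeroˡ c)
  Σℚ-*ʳ f c (x ∷ xs) = ≡.trans (cong (f x * c +_) (Σℚ-*ʳ f c xs)) (sym (*-distribʳ-+ c (f x) _))

  Σℚ-↭ : ∀ (f : A → ℚ) {xs ys} → xs ↭ ys → Σℚ (map f xs) ≡ Σℚ (map f ys)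
  Σℚ-↭ f refl         = ≡.refl
  Σℚ-↭ f (prep x p)   = cong (f x +_) (Σℚ-↭ f p)
  Σℚ-↭ f (swap x y p) = ≡.trans (+-exchange (f x) (f y) _) (cong (λ z → f y + (f x + z)) (Σℚ-↭ f p))
  Σℚ-↭ f (trans p q)  = ≡.trans (Σℚ-↭ f p) (Σℚ-↭ f q)

module CycleGraph (k : ℕ) (σ : Permutation′ (suc (suc (suc k)))) where

  open import Defs
  open CyclicSuccessor k
  open UniqueCounting
  open RationalSums using (Σℚ-↭; Σℚ-cong)
  open import Data.Rational using (ℚ)
  open import Data.Nat using (zero; suc; _+_; _*_; _≤_; _<_; _<?_; _≤?_; s≤s; z≤n; s≤s⁻¹)
  open import Data.Nat.Properties
    using (<-asym; <-cmp; ≤∧≢⇒<; ≮⇒≥; ≤-antisym; <-irrefl; <-≤-trans; ≤-reflexive; ≤-trans; ≤-refl; <⇒≤; *-suc; *-monoʳ-≤; +-cancelʳ-≤; +-comm; module ≤-Reasoning)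
  open import Data.Fin using (Fin; toℕ) renaming (zero to 0F)
  open import Data.Fin.Properties using (toℕ-injective) renaming (_≟_ to _≟ᶠ_)
  open import Data.Fin.Permutation using (_⟨$⟩ʳ_; _⟨$⟩ˡ_; inverseˡ; inverseʳ)
  open import Data.List using (List; []; _∷_; _++_; map; filter; length; allFin)
  open import Data.List.Properties using (length-map; length-tabulate; length-++; map-++; map-∘; length-filter)
  open import Data.List.Membership.Propositional using (_∈_; _∉_)
  open import Data.List.Membership.Propositional.Properties using (∈-map⁺; ∈-map⁻; ∈-filter⁻; ∈-filter⁺; ∈-allFin; ∈-++⁻)
  open import Data.List.Membership.Propositional.Properties.WithK using (unique∧set⇒bag)
  open import Data.List.Relation.Binary.BagAndSetEquality using (∼bag⇒↭)
  open import Data.List.Relation.Binary.Permutation.Propositional using (_↭_; ↭-sym)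
  open import Data.List.Relation.Binary.Permutation.Propositional.Properties using (↭-length)
  open import Data.List.Relation.Binary.Subset.Propositional using (_⊆_)
  open import Data.List.Relation.Unary.Any using (here; there)
  open import Data.List.Relation.Unary.All as All using (All; []; _∷_)
  open import Data.List.Relation.Unary.All.Properties using (¬Any⇒All¬)
  open import Data.List.Relation.Unary.AllPairs using ([]; _∷_)
  open import Data.List.Relation.Unary.Unique.Propositional using (Unique)
  import Data.List.Relation.Unary.Unique.Propositional.Properties as Unique
  open import Data.Product using (∃; Σ-syntax; _×_; _,_; proj₁; proj₂)
  open import Data.Product.Properties using (≡-dec)
  open import Data.Sum using (_⊎_; inj₁; inj₂)
  import Data.Sum as Sum
  open import Data.Unit using (⊤; tt)
  open import Data.Empty using (⊥-elim)
  open import Function.Bundles using (mk⇔; Equivalence)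
  open import Relation.Nullary using (Dec; yes; no; ¬_; ¬?; _⊎-dec_)
  open import Function using (_∘_)
  open import Relation.Unary using (Decidable)
  open import Relation.Binary.Definitions using (DecidableEquality; tri<; tri≈; tri>)
  open import Relation.Binary.PropositionalEquality
    using (_≡_; _≢_; refl; cong; cong₂; sym; trans; subst; module ≡-Reasoning)

  vertex : Fin n → Fin n
  vertex q = σ ⟨$⟩ʳ q

  pos : Fin n → Fin n
  pos v = σ ⟨$⟩ˡ v

  vertex-pos : ∀ v → vertex (pos v) ≡ v
  vertex-pos v = inverseʳ σ

  pos-vertex : ∀ q → pos (vertex q) ≡ q
  pos-vertex q = inverseˡ σ

  vertex-injective : ∀ {a b} → vertex a ≡ vertex b → a ≡ b
  vertex-injective {a} {b} eq = trans (sym (pos-vertex a)) (trans (cong pos eq) (pos-vertex b))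

  pos-injective : ∀ {a b} → pos a ≡ pos b → a ≡ b
  pos-injective {a} {b} eq = trans (sym (vertex-pos a)) (trans (cong vertex eq) (vertex-pos b))

  pos≡⇒≡vertex : ∀ {v q} → pos v ≡ q → v ≡ vertex q
  pos≡⇒≡vertex {v} eq = trans (sym (vertex-pos v)) (cong vertex eq)

  vertex≢vertex-next : ∀ q → vertex q ≢ vertex (next q)
  vertex≢vertex-next q eq = next≢id q (sym (vertex-injective eq))

  _≟ᴱ_ : DecidableEquality (Edge n)
  _≟ᴱ_ = ≡-dec _≟ᶠ_ _≟ᶠ_

  -- The representative of {a , b} that is listed in Generation.allEdges.
  canonical : Fin n → Fin n → Edge n
  canonical a b with toℕ a <? toℕ b
  ... | yes _ = a , b
  ... | no  _ = b , a

  canonical-cases : ∀ a b → canonical a b ≡ (a , b) ⊎ canonical a b ≡ (b , a)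
  canonical-cases a b with toℕ a <? toℕ b
  ... | yes _ = inj₁ refl
  ... | no  _ = inj₂ refl

  canonical-< : ∀ {a b} → toℕ a < toℕ b → canonical a b ≡ (a , b)
  canonical-< {a} {b} a<b with toℕ a <? toℕ b
  ... | yes _   = refl
  ... | no  a≮b = ⊥-elim (a≮b a<b)

  canonical-> : ∀ {a b} → toℕ b < toℕ a → canonical a b ≡ (b , a)
  canonical-> {a} {b} b<a with toℕ a <? toℕ b
  ... | yes a<b = ⊥-elim (<-asym a<b b<a)
  ... | no  _   = refl

  canonical-ordered : ∀ a b → a ≢ b → toℕ (proj₁ (canonical a b)) < toℕ (proj₂ (canonical a b))
  canonical-ordered a b a≢b with toℕ a <? toℕ b
  ... | yes a<b = a<b
  ... | no  a≮b = ≤∧≢⇒< (≮⇒≥ a≮b) (λ eq → a≢b (toℕ-injective (sym eq)))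

  canonical-comm : ∀ a b → a ≢ b → canonical a b ≡ canonical b a
  canonical-comm a b a≢b with <-cmp (toℕ a) (toℕ b)
  ... | tri< a<b _ _ = trans (canonical-< a<b) (sym (canonical-> a<b))
  ... | tri≈ _ a≡b _ = ⊥-elim (a≢b (toℕ-injective a≡b))
  ... | tri> _ _ b<a = trans (canonical-> b<a) (sym (canonical-< b<a))

  canonical-injective : ∀ {a b c d} → canonical a b ≡ canonical c d → (a ≡ c × b ≡ d) ⊎ (a ≡ d × b ≡ c)
  canonical-injective {a} {b} {c} {d} eq with canonical-cases a b | canonical-cases c d
  ... | inj₁ ab | inj₁ cd = inj₁ (pair-injective (trans (sym ab) (trans eq cd)))
    where pair-injective : (a , b) ≡ (c , d) → a ≡ c × b ≡ d
          pair-injective refl = refl , refl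
  ... | inj₁ ab | inj₂ dc = inj₂ (pair-injective (trans (sym ab) (trans eq dc)))
    where pair-injective : (a , b) ≡ (d , c) → a ≡ d × b ≡ c
          pair-injective refl = refl , refl
  ... | inj₂ ba | inj₁ cd = inj₂ (pair-injective (trans (sym ba) (trans eq cd)))
    where pair-injective : (b , a) ≡ (c , d) → a ≡ d × b ≡ c
          pair-injective refl = refl , refl
  ... | inj₂ ba | inj₂ dc = inj₁ (pair-injective (trans (sym ba) (trans eq dc)))
    where pair-injective : (b , a) ≡ (d , c) → a ≡ c × b ≡ d
          pair-injective refl = refl , refl

  canonical→Adj : ∀ {H u v} → canonical u v ∈ H → Adj H u v
  canonical→Adj {H} {u} {v} uv∈H with canonical-cases u v
  ... | inj₁ eq = inj₁ (subst (_∈ H) eq uv∈H)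
  ... | inj₂ eq = inj₂ (subst (_∈ H) eq uv∈H)

  length-allFin : length (allFin n) ≡ n
  length-allFin = length-tabulate {n = n} (λ i → i)

  xEdge : Fin n → Edge n
  xEdge q = canonical (vertex q) (vertex (next q))

  xEdges : List (Edge n)
  xEdges = map xEdge (allFin n)

  xEdge∈xEdges : ∀ q → xEdge q ∈ xEdges
  xEdge∈xEdges q = ∈-map⁺ xEdge (∈-allFin q)

  length-xEdges : length xEdges ≡ n
  length-xEdges = trans (length-map xEdge (allFin n)) length-allFin

  xEdge-injective : ∀ {q q′} → xEdge q ≡ xEdge q′ → q ≡ q′
  xEdge-injective {q} {q′} eq with canonical-injective eq
  ... | inj₁ (q≡q′ , _) = vertex-injective q≡q′
  ... | inj₂ (q≡nq′ , nq≡q′) =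
    ⊥-elim (next²≢id q′ (trans (cong next (sym (vertex-injective q≡nq′))) (vertex-injective nq≡q′)))

  xEdges-unique : Unique xEdges
  xEdges-unique = Unique.map⁺ xEdge-injective (Unique.allFin⁺ n)

  ∈xEdges⁻ : ∀ {e} → e ∈ xEdges → ∃ λ q → e ≡ xEdge q
  ∈xEdges⁻ e∈ with ∈-map⁻ xEdge e∈
  ... | q , _ , eq = q , eq

  ∈xEdges⇒ordered : ∀ {e} → e ∈ xEdges → toℕ (proj₁ e) < toℕ (proj₂ e)
  ∈xEdges⇒ordered e∈ with ∈xEdges⁻ e∈
  ... | q , refl = canonical-ordered (vertex q) (vertex (next q)) (vertex≢vertex-next q)

  InCycle⇒canonical∈xEdges : ∀ {i j} → InCycle σ i j → canonical i j ∈ xEdges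
  InCycle⇒canonical∈xEdges (q , inj₁ (refl , refl)) = xEdge∈xEdges q
  InCycle⇒canonical∈xEdges (q , inj₂ (refl , refl)) =
    subst (_∈ xEdges) (canonical-comm _ _ (vertex≢vertex-next q)) (xEdge∈xEdges q)

  xEdge⇒InCycle : ∀ q {i j} → xEdge q ≡ (i , j) → InCycle σ i j × InCycle σ j i
  xEdge⇒InCycle q {i} {j} eq with canonical-cases (vertex q) (vertex (next q))
  ... | inj₁ eq′ = forward (trans (sym eq′) eq)
    where forward : (vertex q , vertex (next q)) ≡ (i , j) → InCycle σ i j × InCycle σ j i
          forward refl = (q , inj₁ (refl , refl)) , (q , inj₂ (refl , refl))
  ... | inj₂ eq′ = backward (trans (sym eq′) eq)
    where backward : (vertex (next q) , vertex q) ≡ (i , j) → InCycle σ i j × InCycle σ j i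
          backward refl = (q , inj₂ (refl , refl)) , (q , inj₁ (refl , refl))

  ∈xEdges⇒InCycle : ∀ {i j} → (i , j) ∈ xEdges → InCycle σ i j × InCycle σ j i
  ∈xEdges⇒InCycle e∈ with ∈xEdges⁻ e∈
  ... | q , eq = xEdge⇒InCycle q (sym eq)

  PartOfX : List (Edge n) → Set
  PartOfX H = Unique H × H ⊆ xEdges

  PartOfX-∷ : ∀ {B e} → PartOfX B → e ∈ xEdges → e ∉ B → PartOfX (e ∷ B)
  PartOfX-∷ (u , B⊆x) e∈x e∉B = (¬Any⇒All¬ _ e∉B ∷ u) , λ { (here refl) → e∈x ; (there e∈B) → B⊆x e∈B }

  Adj⇒canonical∈ : ∀ {H} → H ⊆ xEdges → ∀ {u v} → Adj H u v → canonical u v ∈ H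
  Adj⇒canonical∈ {H} H⊆x (inj₁ uv∈H) = subst (_∈ H) (sym (canonical-< (∈xEdges⇒ordered (H⊆x uv∈H)))) uv∈H
  Adj⇒canonical∈ {H} H⊆x (inj₂ vu∈H) = subst (_∈ H) (sym (canonical-> (∈xEdges⇒ordered (H⊆x vu∈H)))) vu∈H

  Adj⇒InCycle : ∀ {H} → H ⊆ xEdges → ∀ {u v} → Adj H u v → InCycle σ u v
  Adj⇒InCycle H⊆x (inj₁ uv∈H) = proj₁ (∈xEdges⇒InCycle (H⊆x uv∈H))
  Adj⇒InCycle H⊆x (inj₂ vu∈H) = proj₂ (∈xEdges⇒InCycle (H⊆x vu∈H))

  incident? : ∀ v → Decidable (λ (e : Edge n) → proj₁ e ≡ v ⊎ proj₂ e ≡ v)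
  incident? v e = (proj₁ e ≟ᶠ v) ⊎-dec (proj₂ e ≟ᶠ v)

  xEdge-incident⁻ : ∀ q v → proj₁ (xEdge q) ≡ v ⊎ proj₂ (xEdge q) ≡ v → v ≡ vertex q ⊎ v ≡ vertex (next q)
  xEdge-incident⁻ q v inc with canonical-cases (vertex q) (vertex (next q))
  ... | inj₁ eq rewrite eq = Sum.map sym sym inc
  ... | inj₂ eq rewrite eq = Sum.swap (Sum.map sym sym inc)

  canonical-incidentˡ : ∀ a b → proj₁ (canonical a b) ≡ a ⊎ proj₂ (canonical a b) ≡ a
  canonical-incidentˡ a b with canonical-cases a b
  ... | inj₁ eq rewrite eq = inj₁ refl
  ... | inj₂ eq rewrite eq = inj₂ refl

  canonical-incidentʳ : ∀ a b → proj₁ (canonical a b) ≡ b ⊎ proj₂ (canonical a b) ≡ b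
  canonical-incidentʳ a b with canonical-cases a b
  ... | inj₁ eq rewrite eq = inj₂ refl
  ... | inj₂ eq rewrite eq = inj₁ refl

  xEdges-at : Fin n → List (Edge n)
  xEdges-at v = xEdge (pos v) ∷ xEdge (prev (pos v)) ∷ []

  xEdge-incident⇒∈xEdges-at : ∀ q v → proj₁ (xEdge q) ≡ v ⊎ proj₂ (xEdge q) ≡ v → xEdge q ∈ xEdges-at v
  xEdge-incident⇒∈xEdges-at q v inc with xEdge-incident⁻ q v inc
  ... | inj₁ v≡q  = here (cong xEdge (trans (sym (pos-vertex q)) (cong pos (sym v≡q))))
  ... | inj₂ v≡nq = there (here (cong xEdge (trans (sym (prev-next q))
                      (cong prev (trans (sym (pos-vertex (next q))) (cong pos (sym v≡nq)))))))

  PartOfX⇒deg≤2 : ∀ {G} → PartOfX G → ∀ v → deg G v ≤ 2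
  PartOfX⇒deg≤2 {G} (u , G⊆x) v = Unique⇒length-≤ (Unique.filter⁺ (incident? v) u) incident⊆
    where
    incident⊆ : filter (incident? v) G ⊆ xEdges-at v
    incident⊆ {e} e∈ =
      let e∈G , inc = ∈-filter⁻ (incident? v) e∈
          q , e≡xq  = ∈xEdges⁻ (G⊆x e∈G)
      in subst (_∈ xEdges-at v) (sym e≡xq)
           (xEdge-incident⇒∈xEdges-at q v (subst (λ e → proj₁ e ≡ v ⊎ proj₂ e ≡ v) e≡xq inc))

  xEdges-at-unique : ∀ v → Unique (xEdges-at v)
  xEdges-at-unique v = ((λ eq → next≢id p (trans (cong next (xEdge-injective eq)) (next-prev p))) ∷ []) ∷ [] ∷ []
    where p = pos v

  xEdges-at-incident : ∀ v {e} → e ∈ xEdges-at v → proj₁ e ≡ v ⊎ proj₂ e ≡ v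
  xEdges-at-incident v (here refl) =
    subst (λ w → proj₁ (xEdge (pos v)) ≡ w ⊎ proj₂ (xEdge (pos v)) ≡ w) (vertex-pos v)
      (canonical-incidentˡ (vertex (pos v)) (vertex (next (pos v))))
  xEdges-at-incident v (there (here refl)) =
    subst (λ w → proj₁ (xEdge (prev (pos v))) ≡ w ⊎ proj₂ (xEdge (prev (pos v))) ≡ w)
      (trans (cong vertex (next-prev (pos v))) (vertex-pos v))
      (canonical-incidentʳ (vertex (prev (pos v))) (vertex (next (prev (pos v)))))

  endpoints : List (Edge n) → List (Fin n)
  endpoints []             = []
  endpoints ((a , b) ∷ es) = a ∷ b ∷ endpoints es

  length-endpoints : ∀ es → length (endpoints es) ≡ 2 * length es
  length-endpoints []       = refl
  length-endpoints (e ∷ es) = trans (cong (2 +_) (length-endpoints es)) (sym (*-suc 2 (length es)))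

  ∈-endpoints : ∀ {es e v} → e ∈ es → proj₁ e ≡ v ⊎ proj₂ e ≡ v → v ∈ endpoints es
  ∈-endpoints (here refl) (inj₁ refl) = here refl
  ∈-endpoints (here refl) (inj₂ refl) = there (here refl)
  ∈-endpoints {_ ∷ es} (there e∈) inc = there (there (∈-endpoints e∈ inc))

  module _ (B : List (Edge n)) where
    open import Data.List.Membership.DecPropositional _≟ᴱ_ using (_∈?_)

    private
      ∉B? : Decidable (_∉ B)
      ∉B? e = ¬? (e ∈? B)

    missing : List (Edge n)
    missing = filter ∉B? xEdges

    PartOfX⇒length-missing : PartOfX B → length missing + length B ≤ n
    PartOfX⇒length-missing (uB , B⊆x) = subst (length missing + length B ≤_) length-xEdges (subst (_≤ length xEdges)
      (length-++ missing) (Unique⇒length-≤ (Unique.++⁺ (Unique.filter⁺ ∉B? xEdges-unique) uB disjoint) ⊆x))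
      where
      disjoint : ∀ {e} → ¬ (e ∈ missing × e ∈ B)
      disjoint (e∈missing , e∈B) = proj₂ (∈-filter⁻ ∉B? {xs = xEdges} e∈missing) e∈B
      ⊆x : missing ++ B ⊆ xEdges
      ⊆x e∈ with ∈-++⁻ missing e∈
      ... | inj₁ e∈missing = proj₁ (∈-filter⁻ ∉B? {xs = xEdges} e∈missing)
      ... | inj₂ e∈B       = B⊆x e∈B

    low? : Decidable (λ v → deg B v ≤ 1)
    low? v = deg B v ≤? 1

    lowVertices : List (Fin n)
    lowVertices = filter low? (allFin n)

    -- A vertex of degree ≤ 1 misses one of its two x-edges, so it is an endpoint of a missing edge.
    low⇒∈endpoints : ∀ {v} → deg B v ≤ 1 → v ∈ endpoints missing
    low⇒∈endpoints {v} deg≤1 = by-cases (xEdge (pos v) ∈? B) (xEdge (prev (pos v)) ∈? B)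
      where
      by-cases : Dec (xEdge (pos v) ∈ B) → Dec (xEdge (prev (pos v)) ∈ B) → v ∈ endpoints missing
      by-cases (no e∉B) _ =
        ∈-endpoints (∈-filter⁺ ∉B? (xEdge∈xEdges (pos v)) e∉B) (xEdges-at-incident v (here refl))
      by-cases (yes _) (no e∉B) =
        ∈-endpoints (∈-filter⁺ ∉B? (xEdge∈xEdges (prev (pos v))) e∉B) (xEdges-at-incident v (there (here refl)))
      by-cases (yes e∈B) (yes e′∈B) = ⊥-elim (<-irrefl refl (<-≤-trans (s≤s deg≤1)
        (Unique⇒length-≤ (xEdges-at-unique v) λ where
          (here refl)         → ∈-filter⁺ (incident? v) e∈B (xEdges-at-incident v (here refl))
          (there (here refl)) → ∈-filter⁺ (incident? v) e′∈B (xEdges-at-incident v (there (here refl))))))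

    length-lowVertices≤n : length lowVertices ≤ n
    length-lowVertices≤n = ≤-trans (length-filter low? (allFin n)) (≤-reflexive length-allFin)

  length-lowVertices : ∀ {B} → PartOfX B → ∀ m → length B + m ≡ n → length (lowVertices B) ≤ 2 * m
  length-lowVertices {B} part m B+m≡n = begin
    length (lowVertices B)       ≤⟨ Unique⇒length-≤ (Unique.filter⁺ (low? B) (Unique.allFin⁺ n))
                                      (λ v∈ → low⇒∈endpoints B (proj₂ (∈-filter⁻ (low? B) v∈))) ⟩
    length (endpoints (missing B)) ≡⟨ length-endpoints (missing B) ⟩
    2 * length (missing B)       ≤⟨ *-monoʳ-≤ 2 (+-cancelʳ-≤ (length B) _ _ (≤-trans (PartOfX⇒length-missing B part)
                                      (≤-reflexive (trans (sym B+m≡n) (+-comm (length B) m))))) ⟩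
    2 * m                        ∎
    where open ≤-Reasoning

  Forward Backward Along : Fin n → Fin n → Set
  Forward  a b = pos b ≡ next (pos a)
  Backward a b = pos a ≡ next (pos b)
  Along    a b = Forward a b ⊎ Backward a b

  Chain : (Fin n → Fin n → Set) → List (Fin n) → Set
  Chain R l = All (λ e → R (proj₁ e) (proj₂ e)) (pairs l)

  NoReversal : List (Fin n) → Set
  NoReversal (a ∷ b ∷ c ∷ l) = a ≢ c × NoReversal (b ∷ c ∷ l)
  NoReversal _               = ⊤

  InCycle⇒Along : ∀ {a b} → InCycle σ a b → Along a b
  InCycle⇒Along (q , inj₁ (refl , refl)) = inj₁ (trans (pos-vertex (next q)) (cong next (sym (pos-vertex q))))
  InCycle⇒Along (q , inj₂ (refl , refl)) = inj₂ (trans (pos-vertex (next q)) (cong next (sym (pos-vertex q))))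

  -- Along the cycle a walk can only turn back by revisiting the vertex it just left.
  Chain-direction : ∀ l → Chain Along l → NoReversal l → Chain Forward l ⊎ Chain Backward l
  Chain-direction []              _                 _ = inj₁ []
  Chain-direction (a ∷ [])        _                 _ = inj₁ []
  Chain-direction (a ∷ b ∷ [])    (inj₁ fab ∷ [])   _ = inj₁ (fab ∷ [])
  Chain-direction (a ∷ b ∷ [])    (inj₂ bab ∷ [])   _ = inj₂ (bab ∷ [])
  Chain-direction (a ∷ b ∷ c ∷ l) (along-ab ∷ chain) (a≢c , noRev)
    with Chain-direction (b ∷ c ∷ l) chain noRev | along-ab
  ... | inj₁ (fbc ∷ fwd) | inj₁ fab = inj₁ (fab ∷ fbc ∷ fwd)
  ... | inj₁ (fbc ∷ fwd) | inj₂ bab = ⊥-elim (a≢c (pos-injective (trans bab (sym fbc))))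
  ... | inj₂ (bbc ∷ bwd) | inj₂ bab = inj₂ (bab ∷ bbc ∷ bwd)
  ... | inj₂ (bbc ∷ bwd) | inj₁ fab = ⊥-elim (a≢c (pos-injective (next-injective (trans (sym fab) bbc))))

  Unique⇒NoReversal : ∀ l → Unique l → NoReversal l
  Unique⇒NoReversal []              _ = tt
  Unique⇒NoReversal (a ∷ [])        _ = tt
  Unique⇒NoReversal (a ∷ b ∷ [])    _ = tt
  Unique⇒NoReversal (a ∷ b ∷ c ∷ l) ((_ ∷ a≢c ∷ _) ∷ u) = a≢c , Unique⇒NoReversal (b ∷ c ∷ l) u

  closedWalk-NoReversal : ∀ v₀ rest → 3 ≤ length (v₀ ∷ rest) → Unique (v₀ ∷ rest) →
                          NoReversal (v₀ ∷ rest ++ v₀ ∷ [])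
  closedWalk-NoReversal v₀ (v₁ ∷ v₂ ∷ r) _ u@((_ ∷ v₀≢v₂ ∷ _) ∷ u′) =
    v₀≢v₂ , Unique⇒NoReversal (v₁ ∷ v₂ ∷ r ++ v₀ ∷ [])
              (Unique.++⁺ u′ ([] ∷ []) λ { (v₀∈ , here refl) → Unique.Unique[x∷xs]⇒x∉xs u v₀∈ })
  closedWalk-NoReversal v₀ []       (s≤s ())       _
  closedWalk-NoReversal v₀ (_ ∷ []) (s≤s (s≤s ())) _

  forward-step : ∀ a l → Chain Forward (a ∷ l) → ∀ j → j < length l →
    Σ[ x ∈ Fin n ] Σ[ y ∈ Fin n ] (x , y) ∈ pairs (a ∷ l) × pos x ≡ next^ j (pos a) × pos y ≡ next (pos x)
  forward-step a (b ∷ l) (fab ∷ _)     zero    _         = a , b , here refl , refl , fab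
  forward-step a (b ∷ l) (fab ∷ chain) (suc j) (s≤s j<l) with forward-step b l chain j j<l
  ... | x , y , xy∈ , px , py =
    x , y , there xy∈ , trans px (trans (cong (next^ j) fab) (next^-next j (pos a))) , py

  forward-last : ∀ a l z → Chain Forward (a ∷ l ++ z ∷ []) → pos z ≡ next^ (suc (length l)) (pos a)
  forward-last a []      z (fa ∷ [])     = fa
  forward-last a (b ∷ l) z (fab ∷ chain) = trans (forward-last b l z chain)
    (trans (cong (next^ (suc (length l))) fab) (next^-next (suc (length l)) (pos a)))

  backward-last : ∀ a l z → Chain Backward (a ∷ l ++ z ∷ []) → pos a ≡ next^ (suc (length l)) (pos z)
  backward-last a []      z (ba ∷ [])     = ba
  backward-last a (b ∷ l) z (bab ∷ chain) = trans bab (cong next (backward-last b l z chain))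

  backward-step : ∀ a l z → Chain Backward (a ∷ l ++ z ∷ []) → ∀ j → j < suc (length l) →
    Σ[ x ∈ Fin n ] Σ[ y ∈ Fin n ] (x , y) ∈ pairs (a ∷ l ++ z ∷ []) × pos y ≡ next^ j (pos z) × pos x ≡ next (pos y)
  backward-step a []      z (ba ∷ [])     zero    _         = a , z , here refl , refl , ba
  backward-step a []      z (ba ∷ [])     (suc j) (s≤s ())
  backward-step a (b ∷ l) z (bab ∷ chain) j       j<1+l with j <? suc (length l)
  ... | yes j<l = let x , y , xy∈ , py , px = backward-step b l z chain j j<l in x , y , there xy∈ , py , px
  ... | no  j≮l = a , b , here refl ,
        trans (backward-last b l z chain) (cong (λ t → next^ t (pos z)) (sym j≡1+l)) , bab
    where
    j≡1+l : j ≡ suc (length l)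
    j≡1+l = ≤-antisym (s≤s⁻¹ j<1+l) (≮⇒≥ j≮l)

  -- A closed walk along x without reversals winds around x, so it traverses every edge of x.
  closedWalk-traverses : ∀ v₀ rest → let w = v₀ ∷ rest ++ v₀ ∷ [] in
    Chain Along w → NoReversal w → ∀ q →
    Σ[ x ∈ Fin n ] Σ[ y ∈ Fin n ] (x , y) ∈ pairs w × canonical x y ≡ xEdge q
  closedWalk-traverses v₀ rest along noRev q with Chain-direction (v₀ ∷ rest ++ v₀ ∷ []) along noRev
  ... | inj₁ fwd =
    let j , j<n , jq = next^-reaches (pos v₀) q
        winds = next^-period (suc (length rest)) (pos v₀) (sym (forward-last v₀ rest v₀ fwd)) (s≤s z≤n)
        j<w = subst (j <_) (sym (trans (length-++ rest) (+-comm (length rest) 1))) (<-≤-trans j<n winds)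
        x , y , xy∈ , px , py = forward-step v₀ (rest ++ v₀ ∷ []) fwd j j<w
        px′ = trans px jq
    in x , y , xy∈ , cong₂ canonical (pos≡⇒≡vertex px′) (pos≡⇒≡vertex (trans py (cong next px′)))
  ... | inj₂ bwd =
    let j , j<n , jq = next^-reaches (pos v₀) q
        winds = next^-period (suc (length rest)) (pos v₀) (sym (backward-last v₀ rest v₀ bwd)) (s≤s z≤n)
        x , y , xy∈ , py , px = backward-step v₀ rest v₀ bwd j (<-≤-trans j<n winds)
        py′ = trans py jq
    in x , y , xy∈ , trans (cong₂ canonical (pos≡⇒≡vertex (trans px (cong next py′))) (pos≡⇒≡vertex py′))
                           (canonical-comm _ _ (vertex≢vertex-next q ∘ sym))

  cycle-covers-x : ∀ {H} → PartOfX H → HasCycle H → xEdges ⊆ H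
  cycle-covers-x {H} (_ , H⊆x) (v₀ ∷ rest , 3≤len , u , adj) e∈x =
    let q , e≡xq = ∈xEdges⁻ e∈x
        along = All.map (InCycle⇒Along ∘ Adj⇒InCycle H⊆x) adj
        x , y , xy∈ , xy≡xq = closedWalk-traverses v₀ rest along (closedWalk-NoReversal v₀ rest 3≤len u) q
    in subst (_∈ H) (trans xy≡xq (sym e≡xq)) (Adj⇒canonical∈ H⊆x (All.lookup adj xy∈))

  PartOfX-acyclic : ∀ {H} → PartOfX H → length H < n → ¬ HasCycle H
  PartOfX-acyclic {H} part H<n cycle = <-irrefl refl (<-≤-trans H<n
    (subst (_≤ length H) length-xEdges (Unique⇒length-≤ xEdges-unique (cycle-covers-x part cycle))))

  orbit : Fin n → ℕ → List (Fin n)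
  orbit p zero    = []
  orbit p (suc m) = p ∷ orbit (next p) m

  orbit-∷ʳ : ∀ p m → orbit p (suc m) ≡ orbit p m ++ next^ m p ∷ []
  orbit-∷ʳ p zero    = refl
  orbit-∷ʳ p (suc m) = cong (p ∷_) (trans (orbit-∷ʳ (next p) m)
    (cong (λ t → orbit (next p) m ++ t ∷ []) (next^-next m p)))

  ∈-orbit⁻ : ∀ p m {x} → x ∈ orbit p m → ∃ λ j → j < m × x ≡ next^ j p
  ∈-orbit⁻ p (suc m) (here refl) = zero , s≤s z≤n , refl
  ∈-orbit⁻ p (suc m) (there x∈) with ∈-orbit⁻ (next p) m x∈
  ... | j , j<m , x≡ = suc j , s≤s j<m , trans x≡ (next^-next j p)

  ∈-orbit⁺ : ∀ p m j → j < m → next^ j p ∈ orbit p m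
  ∈-orbit⁺ p (suc m) zero    _         = here refl
  ∈-orbit⁺ p (suc m) (suc j) (s≤s j<m) = there (subst (_∈ orbit (next p) m) (next^-next j p) (∈-orbit⁺ (next p) m j j<m))

  orbit-unique : ∀ p m → m ≤ n → Unique (orbit p m)
  orbit-unique p zero    _   = []
  orbit-unique p (suc m) m<n = ¬Any⇒All¬ _ p∉ ∷ orbit-unique (next p) m (<⇒≤ m<n)
    where
    p∉ : p ∉ orbit (next p) m
    p∉ p∈ with ∈-orbit⁻ (next p) m p∈
    ... | j , j<m , p≡ = <-irrefl refl (<-≤-trans (<-≤-trans (s≤s j<m) m<n)
                           (next^-period (suc j) p (sym (trans p≡ (next^-next j p))) (s≤s z≤n)))

  ∈-pairs-orbit⁻ : ∀ p m {x y} → (x , y) ∈ pairs (orbit p m) → y ≡ next x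
  ∈-pairs-orbit⁻ p (suc (suc m)) (here refl) = refl
  ∈-pairs-orbit⁻ p (suc (suc m)) (there xy∈) = ∈-pairs-orbit⁻ (next p) (suc m) xy∈

  ∈-pairs-orbit⁺ : ∀ p m j → j < m → (next^ j p , next (next^ j p)) ∈ pairs (orbit p (suc m))
  ∈-pairs-orbit⁺ p (suc m) zero    _         = here refl
  ∈-pairs-orbit⁺ p (suc m) (suc j) (s≤s j<m) = there
    (subst (λ t → (t , next t) ∈ pairs (orbit (next p) (suc m))) (next^-next j p) (∈-pairs-orbit⁺ (next p) m j j<m))

  pairs-map : ∀ (f : Fin n → Fin n) l → pairs (map f l) ≡ map (λ e → f (proj₁ e) , f (proj₂ e)) (pairs l)
  pairs-map f []          = refl
  pairs-map f (a ∷ [])    = refl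
  pairs-map f (a ∷ b ∷ l) = cong ((f a , f b) ∷_) (pairs-map f (b ∷ l))

  tour : List (Fin n)
  tour = map vertex (orbit 0F n)

  cycEdges-tour : cycEdges tour ≡ map (λ e → vertex (proj₁ e) , vertex (proj₂ e)) (pairs (orbit 0F (suc n)))
  cycEdges-tour = trans (cong pairs closed) (pairs-map vertex (orbit 0F (suc n)))
    where
    closed : tour ++ vertex 0F ∷ [] ≡ map vertex (orbit 0F (suc n))
    closed = begin
      tour ++ vertex 0F ∷ []                 ≡⟨ map-++ vertex (orbit 0F n) (0F ∷ []) ⟨
      map vertex (orbit 0F n ++ 0F ∷ [])      ≡⟨ cong (λ p → map vertex (orbit 0F n ++ p ∷ [])) (next^n≡id 0F) ⟨
      map vertex (orbit 0F n ++ next^ n 0F ∷ [])  ≡⟨ cong (map vertex) (orbit-∷ʳ 0F n) ⟨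
      map vertex (orbit 0F (suc n))           ∎
      where open ≡-Reasoning

  cycEdges-tour⇒InCycle : ∀ {u v} → (u , v) ∈ cycEdges tour → InCycle σ u v
  cycEdges-tour⇒InCycle {u} {v} uv∈ with ∈-map⁻ _ (subst ((u , v) ∈_) cycEdges-tour uv∈)
  ... | (p , p′) , pp′∈ , refl = p , inj₁ (refl , cong vertex (∈-pairs-orbit⁻ 0F (suc n) pp′∈))

  InCycle⇒Adj-tour : ∀ {u v} → InCycle σ u v → Adj (cycEdges tour) u v
  InCycle⇒Adj-tour (q , inj₁ (refl , refl)) = inj₁ (step∈ q)
    where
    step∈ : ∀ q → (vertex q , vertex (next q)) ∈ cycEdges tour
    step∈ q with next^-reaches 0F q
    ... | j , j<n , refl = subst ((vertex (next^ j 0F) , vertex (next (next^ j 0F))) ∈_) (sym cycEdges-tour)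
      (∈-map⁺ (λ e → vertex (proj₁ e) , vertex (proj₂ e)) (∈-pairs-orbit⁺ 0F n j j<n))
  InCycle⇒Adj-tour (q , inj₂ (refl , refl)) = Sum.swap (InCycle⇒Adj-tour (q , inj₁ (refl , refl)))

  tour↭allFin : tour ↭ allFin n
  tour↭allFin = ∼bag⇒↭ (unique∧set⇒bag (Unique.map⁺ vertex-injective (orbit-unique 0F n ≤-refl))
    (Unique.allFin⁺ n) (λ {v} → mk⇔ (λ _ → ∈-allFin v) (λ _ → in-tour v)))
    where
    in-tour : ∀ v → v ∈ tour
    in-tour v with next^-reaches 0F (pos v)
    ... | j , j<n , j≡ = subst (_∈ tour) (trans (cong vertex j≡) (vertex-pos v)) (∈-map⁺ vertex (∈-orbit⁺ 0F n j j<n))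

  xEdges⊆complete : ∀ {H} → PartOfX H → length H ≡ n → xEdges ⊆ H
  xEdges⊆complete (u , H⊆x) H≡n = Unique∧⊆∧length-≥⇒⊇ _≟ᴱ_ u H⊆x (≤-reflexive (trans length-xEdges (sym H≡n)))

  PartOfX-complete⇒ham : ∀ {H} → PartOfX H → length H ≡ n → IsHamCycle H
  PartOfX-complete⇒ham {H} part@(_ , H⊆x) H≡n = tour , tour↭allFin , λ u v →
    mk⇔ (InCycle⇒Adj-tour ∘ Adj⇒InCycle H⊆x)
        (λ adj → canonical→Adj (xEdges⊆complete part H≡n (InCycle⇒canonical∈xEdges (Adj-tour⇒InCycle adj))))
    where
    Adj-tour⇒InCycle : ∀ {u v} → Adj (cycEdges tour) u v → InCycle σ u v
    Adj-tour⇒InCycle (inj₁ uv∈) = cycEdges-tour⇒InCycle uv∈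
    Adj-tour⇒InCycle (inj₂ vu∈) with cycEdges-tour⇒InCycle vu∈
    ... | q , inj₁ eqs = q , inj₂ eqs
    ... | q , inj₂ eqs = q , inj₁ eqs

  PartOfX-incomplete⇒¬ham : ∀ {H} → PartOfX H → length H < n → ¬ IsHamCycle H
  PartOfX-incomplete⇒¬ham part H<n (vs , vs↭ , adj⇔) = PartOfX-acyclic part H<n
    (vs , 3≤len , Unique-resp-↭ (↭-sym vs↭) (Unique.allFin⁺ n) ,
     All.tabulate λ {e} e∈ → Equivalence.from (adj⇔ (proj₁ e) (proj₂ e)) (inj₁ e∈))
    where
    3≤len : 3 ≤ length vs
    3≤len = subst (3 ≤_) (sym (trans (↭-length vs↭) length-allFin)) (s≤s (s≤s (s≤s z≤n)))

  edgeCost-complete : ∀ (d : Fin n → Fin n → ℚ) → (∀ i j → d i j ≡ d j i) →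
    ∀ {H} → PartOfX H → length H ≡ n → edgeCost d H ≡ tourCost d σ
  edgeCost-complete d d-sym {H} part@(u , H⊆x) H≡n = begin
    Σℚ (map cost H)                                    ≡⟨ Σℚ-↭ cost H↭x ⟩
    Σℚ (map cost (map xEdge (allFin n)))               ≡⟨ cong Σℚ (map-∘ {g = cost} {f = xEdge} (allFin n)) ⟨
    Σℚ (map (cost ∘ xEdge) (allFin n))                 ≡⟨ Σℚ-cong (cost ∘ xEdge) (λ q → d (vertex q) (vertex (next q))) (allFin n) (λ {q} _ → cost-xEdge q) ⟩
    Σℚ (map (λ q → d (vertex q) (vertex (next q))) (allFin n)) ∎
    where
    open ≡-Reasoning
    cost : Edge n → ℚ
    cost e = d (proj₁ e) (proj₂ e)
    H↭x : H ↭ xEdges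
    H↭x = ∼bag⇒↭ (unique∧set⇒bag u xEdges-unique (mk⇔ H⊆x (xEdges⊆complete part H≡n)))
    cost-xEdge : ∀ q → cost (xEdge q) ≡ d (vertex q) (vertex (next q))
    cost-xEdge q with canonical-cases (vertex q) (vertex (next q))
    ... | inj₁ eq = cong cost eq
    ... | inj₂ eq = trans (cong cost eq) (d-sym _ _)

module PhaseInequalities where

  open import Data.Nat using (ℕ; suc; _+_; _*_; _%_; _≤_; s≤s; s≤s⁻¹)
  open import Data.Nat.Properties
  open import Data.Nat.DivMod using (m≡m%n+[m/n]*n; m%n<n; /-monoˡ-≤)
  open import Data.Nat.Tactic.RingSolver using (solve-∀)
  open import Data.Product using (∃; _×_; _,_)
  open import Relation.Binary.PropositionalEquality using (_≡_; refl; cong; sym; trans; subst)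
  open ≤-Reasoning

  -- 1 + τ i = 2 (i + 1) (i + 2)
  τ : ℕ → ℕ
  τ i = 2 * i * i + 6 * i + 3

  phase₁-step : ∀ g j D a b → suc j ≤ a → b ≤ (2 * suc j) * (2 * suc j) → 4 * suc j * suc (g + j) ≤ D →
    suc g * suc (g + j) * (D * a + b) ≤ D * a * suc g * suc (g + suc j)
  phase₁-step g j D a b j<a b≤ room = begin
    suc g * suc (g + j) * (D * a + b)                      ≡⟨ expand g j D a b ⟩
    suc g * (suc (g + j) * (D * a) + suc (g + j) * b)      ≤⟨ *-monoʳ-≤ (suc g) (+-monoʳ-≤ (suc (g + j) * (D * a)) small) ⟩
    suc g * (suc (g + j) * (D * a) + D * a)                ≡⟨ collect g j D a ⟩
    D * a * suc g * suc (g + suc j)                        ∎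
    where
    expand : ∀ g j D a b → suc g * suc (g + j) * (D * a + b) ≡ suc g * (suc (g + j) * (D * a) + suc (g + j) * b)
    expand = solve-∀
    collect : ∀ g j D a → suc g * (suc (g + j) * (D * a) + D * a) ≡ D * a * suc g * suc (g + suc j)
    collect = solve-∀
    regroup : ∀ g j → suc (g + j) * ((2 * suc j) * (2 * suc j)) ≡ suc j * (4 * suc j * suc (g + j))
    regroup = solve-∀
    small : suc (g + j) * b ≤ D * a
    small = begin
      suc (g + j) * b                            ≤⟨ *-monoʳ-≤ (suc (g + j)) b≤ ⟩
      suc (g + j) * ((2 * suc j) * (2 * suc j))  ≡⟨ regroup g j ⟩
      suc j * (4 * suc j * suc (g + j))          ≤⟨ *-mono-≤ j<a room ⟩
      a * D                                      ≡⟨ *-comm a D ⟩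
      D * a                                      ∎

  phase₂-step : ∀ H i D a b N → suc (suc (suc i)) ≤ a → b ≤ N → N ≤ 2 * D →
    H * suc (τ i) * (D * a + b) ≤ D * a * H * suc (τ (suc i))
  phase₂-step H i D a b N 2+i<a b≤N N≤2D = begin
    H * suc (τ i) * (D * a + b)                                                 ≡⟨ expand H i D a b ⟩
    H * (2 * suc i * suc (suc i) * (D * a) + 2 * suc (suc i) * (suc i * b))     ≤⟨ *-monoʳ-≤ H (+-monoʳ-≤ (2 * suc i * suc (suc i) * (D * a)) (*-monoʳ-≤ (2 * suc (suc i)) small)) ⟩
    H * (2 * suc i * suc (suc i) * (D * a) + 2 * suc (suc i) * (2 * D * a))     ≡⟨ collect H i D a ⟩
    D * a * H * suc (τ (suc i))                                                 ∎
    where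
    expand : ∀ H i D a b → H * suc (2 * i * i + 6 * i + 3) * (D * a + b) ≡
                           H * (2 * suc i * suc (suc i) * (D * a) + 2 * suc (suc i) * (suc i * b))
    expand = solve-∀
    collect : ∀ H i D a → H * (2 * suc i * suc (suc i) * (D * a) + 2 * suc (suc i) * (2 * D * a)) ≡
                          D * a * H * suc (2 * suc i * suc i + 6 * suc i + 3)
    collect = solve-∀
    small : suc i * b ≤ 2 * D * a
    small = begin
      suc i * b        ≤⟨ *-monoʳ-≤ (suc i) (≤-trans b≤N N≤2D) ⟩
      suc i * (2 * D)  ≤⟨ *-monoˡ-≤ (2 * D) (≤-trans (n≤1+n (suc i)) (≤-trans (n≤1+n (suc (suc i))) 2+i<a)) ⟩
      a * (2 * D)      ≡⟨ *-comm a (2 * D) ⟩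
      2 * D * a        ∎

  phase₁-end≡phase₂-start : ∀ g → (suc (suc g) * suc g) * suc (suc g + suc (suc g)) ≡ suc (suc g) * suc (τ g)
  phase₁-end≡phase₂-start = identity
    where
    identity : ∀ g → (suc (suc g) * suc g) * suc (suc g + suc (suc g)) ≡ suc (suc g) * suc (2 * g * g + 6 * g + 3)
    identity = solve-∀

  quarter : ∀ k → 8 ≤ k → ∃ λ g → 4 * suc (suc g) ≤ k × k ≤ 3 + 4 * suc (suc g)
  quarter k 8≤k with m≤n⇒∃[o]m+o≡n (/-monoˡ-≤ 4 8≤k)
  ... | g , 2+g≡k/4 = g , subst (4 * suc (suc g) ≤_) (sym k≡) (m≤n+m _ (k % 4)) ,
                          subst (_≤ 3 + 4 * suc (suc g)) (sym k≡) (+-monoˡ-≤ _ (s≤s⁻¹ (m%n<n k 4)))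
    where
    k≡ : k ≡ k % 4 + 4 * suc (suc g)
    k≡ = trans (m≡m%n+[m/n]*n k 4) (cong (k % 4 +_) (trans (cong (_* 4) (sym 2+g≡k/4)) (*-comm (suc (suc g)) 4)))

  phase₁-room : ∀ g k → 4 * suc (suc g) ≤ k →
                4 * suc (suc (suc g)) * suc (suc (suc g) + suc (suc g)) ≤ suc (suc k) * suc k
  phase₁-room g k 4[g+2]≤k = begin
    4 * suc (suc (suc g)) * suc (suc (suc g) + suc (suc g))                        ≤⟨ m≤m+n _ (8 * g * g + 32 * g + 30) ⟩
    4 * suc (suc (suc g)) * suc (suc (suc g) + suc (suc g)) + (8 * g * g + 32 * g + 30) ≡⟨ identity g ⟩
    suc (suc (4 * suc (suc g))) * suc (4 * suc (suc g))                            ≤⟨ *-mono-≤ (s≤s (s≤s 4[g+2]≤k)) (s≤s 4[g+2]≤k) ⟩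
    suc (suc k) * suc k                                                            ∎
    where
    identity : ∀ g → 4 * suc (suc (suc g)) * suc (suc (suc g) + suc (suc g)) + (8 * g * g + 32 * g + 30) ≡
                     suc (suc (4 * suc (suc g))) * suc (4 * suc (suc g))
    identity = solve-∀

  n²≤2[n-1][n-2] : ∀ k → 3 ≤ k → suc (suc (suc k)) * suc (suc (suc k)) ≤ 2 * (suc (suc k) * suc k)
  n²≤2[n-1][n-2] k 3≤k with m≤n⇒∃[o]m+o≡n 3≤k
  ... | m , refl = begin
    suc (suc (suc (3 + m))) * suc (suc (suc (3 + m)))                         ≤⟨ m≤m+n _ (m * m + 6 * m + 4) ⟩
    suc (suc (suc (3 + m))) * suc (suc (suc (3 + m))) + (m * m + 6 * m + 4)   ≡⟨ identity m ⟩
    2 * (suc (suc (3 + m)) * suc (3 + m))                                     ∎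
    where
    identity : ∀ m → suc (suc (suc (3 + m))) * suc (suc (suc (3 + m))) + (m * m + 6 * m + 4) ≡
                     2 * (suc (suc (3 + m)) * suc (3 + m))
    identity = solve-∀

  final-constant : ∀ g k → k ≤ 3 + 4 * suc (suc g) → 1 * suc (τ (suc k)) ≤ suc (suc (suc g)) * suc (suc g) * 64
  final-constant g k k≤ = begin
    1 * suc (τ (suc k))                                                   ≡⟨ factor k ⟩
    2 * (k + 2) * (k + 3)                                                 ≤⟨ *-mono-≤ (*-monoʳ-≤ 2 (+-monoˡ-≤ 2 k≤)) (+-monoˡ-≤ 3 k≤) ⟩
    2 * ((3 + 4 * suc (suc g)) + 2) * ((3 + 4 * suc (suc g)) + 3)         ≤⟨ m≤m+n _ (32 * g * g + 104 * g + 20) ⟩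
    2 * ((3 + 4 * suc (suc g)) + 2) * ((3 + 4 * suc (suc g)) + 3) + (32 * g * g + 104 * g + 20) ≡⟨ identity g ⟩
    suc (suc (suc g)) * suc (suc g) * 64                                  ∎
    where
    factor : ∀ x → 1 * suc (2 * suc x * suc x + 6 * suc x + 3) ≡ 2 * (x + 2) * (x + 3)
    factor = solve-∀
    identity : ∀ g → 2 * ((3 + 4 * suc (suc g)) + 2) * ((3 + 4 * suc (suc g)) + 3) + (32 * g * g + 104 * g + 20) ≡
                     suc (suc (suc g)) * suc (suc g) * 64
    identity = solve-∀

module ChoiceRatio where

  open RationalArithmetic
  open import Data.Nat as ℕ using (suc)
  open import Data.Rational using (ℚ; 0ℚ; 1ℚ; _+_; _*_; _≤_; _<_)
  open import Data.Rational.Properties using (<⇒≤; +-monoʳ-≤; *-assoc; *-identityʳ; module ≤-Reasoning)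
  open import Data.Rational.Solver using (module +-*-Solver)
  open +-*-Solver
  open import Relation.Binary.PropositionalEquality using (_≡_; refl; cong; cong₂; trans)

  -- If a edges of weight α and b edges of weight β ≤ α / D compete and c = 1 / (a α + b β), then
  -- a α c ≥ D a / (D a + b); the cross-multiplied hypothesis makes this at least (u′/(1+v′)) / (u/(1+v)).
  choice-ratio : ∀ {α β c : ℚ} a b D u v u′ v′ →
    0ℚ < α → 0ℚ ≤ β → 0ℚ < fromℕ D → fromℕ D * β ≤ α → 0ℚ ≤ c →
    (fromℕ a * α + fromℕ b * β) * c ≡ 1ℚ →
    u′ ℕ.* suc v ℕ.* (D ℕ.* a ℕ.+ b) ℕ.≤ D ℕ.* a ℕ.* u ℕ.* suc v′ →
    u′ /1+ v′ ≤ fromℕ a * α * c * u /1+ v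
  choice-ratio {α} {β} {c} a b D u v u′ v′ 0<α 0≤β 0<D Dβ≤α 0≤c Wc≡1 cross = begin
    G′                ≡⟨ *-identityʳ G′ ⟨
    G′ * 1ℚ           ≡⟨ cong (G′ *_) Wc≡1 ⟨
    G′ * (W * c)      ≡⟨ *-assoc G′ W c ⟨
    G′ * W * c        ≤⟨ *-monoʳ-≤-0≤ 0≤c G′W≤XG ⟩
    X * G * c         ≡⟨ swap X G c ⟩
    X * c * G         ∎
    where
    open ≤-Reasoning
    X  = fromℕ a * α
    W  = X + fromℕ b * β
    G  = u /1+ v
    G′ = u′ /1+ v′
    D′ = fromℕ D
    N  = fromℕ (suc v)
    N′ = fromℕ (suc v′)
    swap : ∀ x g c → x * g * c ≡ x * c * g
    swap = solve 3 (λ x g c → x :* g :* c := x :* c :* g) refl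
    expand : ∀ g′ n′ n d′ a′ α′ b′ β′ → g′ * (a′ * α′ + b′ * β′) * (d′ * (n * n′)) ≡
                                       (g′ * n′) * n * (d′ * (a′ * α′) + b′ * (d′ * β′))
    expand = solve 8 (λ g′ n′ n d′ a′ α′ b′ β′ → g′ :* (a′ :* α′ :+ b′ :* β′) :* (d′ :* (n :* n′)) :=
                                                (g′ :* n′) :* n :* (d′ :* (a′ :* α′) :+ b′ :* (d′ :* β′))) refl
    factor-α : ∀ u′ n d′ a′ α′ b′ → u′ * n * (d′ * (a′ * α′) + b′ * α′) ≡ α′ * (u′ * n * (d′ * a′ + b′))
    factor-α = solve 6 (λ u′ n d′ a′ α′ b′ → u′ :* n :* (d′ :* (a′ :* α′) :+ b′ :* α′) :=
                                             α′ :* (u′ :* n :* (d′ :* a′ :+ b′))) refl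
    regroup : ∀ α′ d′ a′ g n n′ → α′ * (d′ * a′ * (g * n) * n′) ≡ a′ * α′ * g * (d′ * (n * n′))
    regroup = solve 6 (λ α′ d′ a′ g n n′ → α′ :* (d′ :* a′ :* (g :* n) :* n′) := a′ :* α′ :* g :* (d′ :* (n :* n′))) refl
    lhs-cast : fromℕ (u′ ℕ.* suc v ℕ.* (D ℕ.* a ℕ.+ b)) ≡ fromℕ u′ * N * (D′ * fromℕ a + fromℕ b)
    lhs-cast = trans (fromℕ-* (u′ ℕ.* suc v) _)
      (cong₂ _*_ (fromℕ-* u′ (suc v)) (trans (fromℕ-+ (D ℕ.* a) b) (cong (_+ fromℕ b) (fromℕ-* D a))))
    rhs-cast : fromℕ (D ℕ.* a ℕ.* u ℕ.* suc v′) ≡ D′ * fromℕ a * fromℕ u * N′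
    rhs-cast = trans (fromℕ-* (D ℕ.* a ℕ.* u) _) (cong (_* N′) (trans (fromℕ-* (D ℕ.* a) u) (cong (_* fromℕ u) (fromℕ-* D a))))
    G′W≤XG : G′ * W ≤ X * G
    G′W≤XG = *-cancelʳ-≤-0< {D′ * (N * N′)} (0<* 0<D (0<* (0<fromℕ v) (0<fromℕ v′))) (begin
      G′ * W * (D′ * (N * N′))                        ≡⟨ expand G′ N′ N D′ (fromℕ a) α (fromℕ b) β ⟩
      (G′ * N′) * N * (D′ * X + fromℕ b * (D′ * β))   ≡⟨ cong (λ z → z * N * (D′ * X + fromℕ b * (D′ * β))) (/1+-*-cancel u′ v′) ⟩
      fromℕ u′ * N * (D′ * X + fromℕ b * (D′ * β))   ≤⟨ *-monoˡ-≤-0≤ (0≤* (0≤fromℕ u′) (0≤fromℕ (suc v)))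
                                                           (+-monoʳ-≤ (D′ * X) (*-monoˡ-≤-0≤ (0≤fromℕ b) Dβ≤α)) ⟩
      fromℕ u′ * N * (D′ * X + fromℕ b * α)          ≡⟨ factor-α (fromℕ u′) N D′ (fromℕ a) α (fromℕ b) ⟩
      α * (fromℕ u′ * N * (D′ * fromℕ a + fromℕ b))  ≡⟨ cong (α *_) lhs-cast ⟨
      α * fromℕ (u′ ℕ.* suc v ℕ.* (D ℕ.* a ℕ.+ b))   ≤⟨ *-monoˡ-≤-0≤ (<⇒≤ 0<α) (fromℕ-mono-≤ cross) ⟩
      α * fromℕ (D ℕ.* a ℕ.* u ℕ.* suc v′)           ≡⟨ cong (α *_) rhs-cast ⟩
      α * (D′ * fromℕ a * fromℕ u * N′)              ≡⟨ cong (λ z → α * (D′ * fromℕ a * z * N′)) (/1+-*-cancel u v) ⟨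
      α * (D′ * fromℕ a * (G * N) * N′)              ≡⟨ regroup α D′ (fromℕ a) G N N′ ⟩
      X * G * (D′ * (N * N′))                        ∎)

module SuccessProbability (k : ℕ)
  (cyc? : (G : List (Edge (suc (suc (suc k))))) → Dec (HasCycle G))
  (ham? : (G : List (Edge (suc (suc (suc k))))) → Dec (IsHamCycle G))
  (σ : Permutation′ (suc (suc (suc k))))
  (d : Fin (suc (suc (suc k))) → Fin (suc (suc (suc k))) → ℚ)
  (d-sym : ∀ i j → d i j ≡ d j i) where

  open import Defs
  open CyclicSuccessor k using (n)
  open CycleGraph k σ
  open UniqueCounting
  open RationalArithmetic
  open RationalSums
  open ChoiceRatio
  open Generation n cyc? ham?
  open import Data.Nat as ℕ using (zero; suc; _≤_; _<_; s≤s; z≤n)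
  import Data.Nat.Properties as ℕ
  open import Data.Nat.Tactic.RingSolver using (solve-∀)
  open import Data.Fin using (toℕ)
  open import Data.Rational using (0ℚ; 1ℚ; _+_; _*_; _-_) renaming (_≤_ to _≤ℚ_; _<_ to _<ℚ_)
  import Data.Rational as ℚ
  open import Data.Rational.Properties as ℚ using (module ≤-Reasoning)
  open import Data.Rational.Solver using (module +-*-Solver)
  open +-*-Solver
  open import Data.List using ([]; _∷_; _++_; map; filter; length; allFin; cartesianProduct)
  open import Data.List.Properties using (length-++)
  open import Data.List.Membership.Propositional using (_∈_; _∉_)
  open import Data.List.Membership.Propositional.Properties
    using (∈-filter⁻; ∈-filter⁺; ∈-cartesianProduct⁺; ∈-allFin; ∈-++⁺ˡ; ∈-++⁺ʳ)
  open import Data.List.Membership.DecPropositional _≟ᴱ_ using (_∈?_)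
  open import Data.List.Relation.Binary.Subset.Propositional using (_⊆_)
  import Data.List.Relation.Unary.Unique.Propositional.Properties as Unique
  open import Data.List.Relation.Unary.AllPairs using ([])
  open import Data.List.Properties using (filter-accept)
  open import Data.Product using (_×_; _,_; proj₁; proj₂)
  open import Data.Sum using (_⊎_; inj₁; inj₂)
  open import Data.Empty using (⊥-elim)
  open import Relation.Nullary using (yes; no; ¬_)
  open import Relation.Unary using (Decidable)
  open import Relation.Unary.Properties using (∁?)
  open import Relation.Binary.PropositionalEquality using (refl; cong; cong₂; sym; trans; subst; module ≡-Reasoning)
  open import Function using (_∘_)

  P : ℕ → List (Edge n) → ℚ
  P = probFrom σ d

  α β : ℚ
  α = πmax n + πmax n
  β = πmin n + πmin n

  -- (n - 1) (n - 2), the ratio πmax / πmin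
  D : ℕ
  D = suc (suc k) ℕ.* suc k

  weight : Edge n → ℚ
  weight = w σ d

  πx-InCycle : ∀ {i j} → InCycle σ i j → πx σ i j ≡ πmax n
  πx-InCycle {i} {j} i~j with inCycle? σ i j
  ... | yes _    = refl
  ... | no  i≁j = ⊥-elim (i≁j i~j)

  πx-¬InCycle : ∀ {i j} → ¬ InCycle σ i j → πx σ i j ≡ πmin n
  πx-¬InCycle {i} {j} i≁j with inCycle? σ i j
  ... | yes i~j = ⊥-elim (i≁j i~j)
  ... | no  _   = refl

  weight-x : ∀ {e} → e ∈ xEdges → weight e ≡ α
  weight-x e∈x = cong₂ _+_ (πx-InCycle (proj₁ (∈xEdges⇒InCycle e∈x))) (πx-InCycle (proj₂ (∈xEdges⇒InCycle e∈x)))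

  ordered? : Decidable (λ (e : Edge n) → toℕ (proj₁ e) < toℕ (proj₂ e))
  ordered? e = toℕ (proj₁ e) ℕ.<? toℕ (proj₂ e)

  ∈allEdges⇒ordered : ∀ {e} → e ∈ allEdges → toℕ (proj₁ e) < toℕ (proj₂ e)
  ∈allEdges⇒ordered e∈ = proj₂ (∈-filter⁻ ordered? {xs = cartesianProduct (allFin n) (allFin n)} e∈)

  ordered⇒∈allEdges : ∀ {e} → toℕ (proj₁ e) < toℕ (proj₂ e) → e ∈ allEdges
  ordered⇒∈allEdges {i , j} i<j = ∈-filter⁺ ordered? (∈-cartesianProduct⁺ (∈-allFin i) (∈-allFin j)) i<j

  weight-¬x : ∀ {e} → e ∈ allEdges → e ∉ xEdges → weight e ≡ β
  weight-¬x {i , j} e∈ e∉x = cong₂ _+_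
    (πx-¬InCycle (λ i~j → e∉x (subst (_∈ xEdges) (canonical-< (∈allEdges⇒ordered e∈)) (InCycle⇒canonical∈xEdges i~j))))
    (πx-¬InCycle (λ j~i → e∉x (subst (_∈ xEdges) (canonical-> (∈allEdges⇒ordered e∈)) (InCycle⇒canonical∈xEdges j~i))))

  πmax*n≡n-1 : πmax n * fromℕ n ≡ fromℕ (suc (suc k))
  πmax*n≡n-1 = trans (identity (recipℕ n) m)
    (trans (cong (λ t → m + (1ℚ - t)) (fromℕ*recipℕ≡1 (suc (suc k))))
      (trans (cong (m +_) (ℚ.+-inverseʳ 1ℚ)) (ℚ.+-identityʳ m)))
    where
    m = fromℕ (suc (suc k))
    identity : ∀ r x → (1ℚ - r) * (1ℚ + x) ≡ x + (1ℚ - (1ℚ + x) * r)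
    identity = solve 2 (λ r x → (con 1ℚ :- r) :* (con 1ℚ :+ x) := x :+ (con 1ℚ :- (con 1ℚ :+ x) :* r)) refl

  0<πmax : 0ℚ <ℚ πmax n
  0<πmax = ℚ.*-cancelʳ-<-nonNeg (fromℕ n) {{ℚ.nonNegative (0≤fromℕ n)}}
    (subst₂ (ℚ.*-zeroˡ (fromℕ n)) πmax*n≡n-1 (0<fromℕ (suc k)))
    where
    subst₂ : ∀ {p q r s} → r ≡ p → s ≡ q → p <ℚ q → r <ℚ s
    subst₂ refl refl p<q = p<q

  0<α : 0ℚ <ℚ α
  0<α = ℚ.+-mono-< 0<πmax 0<πmax

  0≤β : 0ℚ ≤ℚ β
  0≤β = 0≤+ (0≤recipℕ (n ℕ.* suc k)) (0≤recipℕ (n ℕ.* suc k))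

  D*πmin≡πmax : fromℕ D * πmin n ≡ πmax n
  D*πmin≡πmax = *-cancelʳ-≡ (begin
    fromℕ D * πmin n * fromℕ M          ≡⟨ ℚ.*-assoc (fromℕ D) _ _ ⟩
    fromℕ D * (πmin n * fromℕ M)        ≡⟨ cong (fromℕ D *_) (trans (ℚ.*-comm (πmin n) (fromℕ M)) (fromℕ*recipℕ≡1 M′)) ⟩
    fromℕ D * 1ℚ                        ≡⟨ ℚ.*-identityʳ _ ⟩
    fromℕ (suc (suc k) ℕ.* suc k)       ≡⟨ fromℕ-* (suc (suc k)) (suc k) ⟩
    fromℕ (suc (suc k)) * fromℕ (suc k) ≡⟨ cong (_* fromℕ (suc k)) πmax*n≡n-1 ⟨
    πmax n * fromℕ n * fromℕ (suc k)    ≡⟨ ℚ.*-assoc (πmax n) _ _ ⟩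
    πmax n * (fromℕ n * fromℕ (suc k))  ≡⟨ cong (πmax n *_) (fromℕ-* n (suc k)) ⟨
    πmax n * fromℕ M                    ∎)
    where
    open ≡-Reasoning
    M′ = k ℕ.+ suc (suc k) ℕ.* suc k
    M  = suc M′
    *-cancelʳ-≡ : ∀ {p q} → p * fromℕ M ≡ q * fromℕ M → p ≡ q
    *-cancelʳ-≡ eq = ℚ.≤-antisym (*-cancelʳ-≤-0< (0<fromℕ M′) (ℚ.≤-reflexive eq))
                                 (*-cancelʳ-≤-0< (0<fromℕ M′) (ℚ.≤-reflexive (sym eq)))

  D*β≡α : fromℕ D * β ≡ α
  D*β≡α = trans (ℚ.*-distribˡ-+ (fromℕ D) (πmin n) (πmin n)) (cong₂ _+_ D*πmin≡πmax D*πmin≡πmax)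

  0≤weight : ∀ e → 0ℚ ≤ℚ weight e
  0≤weight (i , j) = 0≤+ (0≤πx i j) (0≤πx j i)
    where
    0≤πx : ∀ i j → 0ℚ ≤ℚ πx σ i j
    0≤πx i j with inCycle? σ i j
    ... | yes _ = ℚ.<⇒≤ 0<πmax
    ... | no  _ = 0≤recipℕ (n ℕ.* suc k)

  0≤P : ∀ m B → 0ℚ ≤ℚ P m B
  0≤P m B with ham? B
  ... | yes _ = 0≤event
    where
    0≤event : 0ℚ ≤ℚ event σ d B
    0≤event with edgeCost d B ℚ.≤? tourCost d σ
    ... | yes _ = ℚ.nonNegative⁻¹ 1ℚ
    ... | no  _ = ℚ.≤-refl
  0≤P zero    B | no _ = ℚ.≤-refl
  0≤P (suc m) B | no _ = 0≤Σℚ _ (filter (admissible? B) allEdges) λ {e} _ →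
    0≤* (0≤divℚ (weight e) _ (0≤weight e) (0≤Σℚ weight (filter (admissible? B) allEdges) λ {e′} _ → 0≤weight e′))
        (0≤P m (e ∷ B))

  x-admissible : ∀ {B e} → PartOfX B → length B < n → e ∈ xEdges → e ∉ B → Admissible B e
  x-admissible {B} {e} part B<n e∈x e∉B = e∉B , PartOfX⇒deg≤2 part′ , acyclic-or-ham
    where
    part′ = PartOfX-∷ part e∈x e∉B
    acyclic-or-ham : ¬ HasCycle (e ∷ B) ⊎ IsHamCycle (e ∷ B)
    acyclic-or-ham with suc (length B) ℕ.<? n
    ... | yes 1+B<n = inj₁ (PartOfX-acyclic part′ 1+B<n)
    ... | no  1+B≮n = inj₂ (PartOfX-complete⇒ham part′ (ℕ.≤-antisym B<n (ℕ.≮⇒≥ 1+B≮n)))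

  complete-success : ∀ B → PartOfX B → length B ≡ n → 1ℚ ≤ℚ P zero B
  complete-success B part B≡n with ham? B
  ... | no ¬ham = ⊥-elim (¬ham (PartOfX-complete⇒ham part B≡n))
  ... | yes _ with edgeCost d B ℚ.≤? tourCost d σ
  ...   | yes _      = ℚ.≤-refl
  ...   | no  cost≰ = ⊥-elim (cost≰ (ℚ.≤-reflexive (edgeCost-complete d d-sym part B≡n)))

  Admissible⇒low : ∀ B e → Admissible B e → deg B (proj₁ e) ≤ 1 × deg B (proj₂ e) ≤ 1
  Admissible⇒low B e (_ , deg≤2 , _) =
    ℕ.s≤s⁻¹ (subst (_≤ 2) (cong length (filter-accept (incident? (proj₁ e)) {e} {B} (inj₁ refl))) (deg≤2 (proj₁ e))) ,
    ℕ.s≤s⁻¹ (subst (_≤ 2) (cong length (filter-accept (incident? (proj₂ e)) {e} {B} (inj₂ refl))) (deg≤2 (proj₂ e)))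

  module Candidates (B : List (Edge n)) (part : PartOfX B) where

    candidates : List (Edge n)
    candidates = filter (admissible? B) allEdges

    ∈x? : Decidable (_∈ xEdges)
    ∈x? e = e ∈? xEdges

    onX offX : List (Edge n)
    onX  = filter ∈x? candidates
    offX = filter (∁? ∈x?) candidates

    many-onX : ∀ m → length B ℕ.+ suc m ≡ n → suc m ≤ length onX
    many-onX m B+m≡n = ℕ.+-cancelˡ-≤ (length B) _ _ (begin
      length B ℕ.+ suc m          ≡⟨ B+m≡n ⟩
      n                           ≡⟨ length-xEdges ⟨
      length xEdges               ≤⟨ Unique⇒length-≤ xEdges-unique x⊆B++onX ⟩
      length (B ++ onX)           ≡⟨ length-++ B ⟩
      length B ℕ.+ length onX     ∎)
      where
      open ℕ.≤-Reasoning
      B<n : length B < n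
      B<n = subst (length B <_) B+m≡n (ℕ.m<m+n (length B) (s≤s z≤n))
      x⊆B++onX : xEdges ⊆ B ++ onX
      x⊆B++onX {e} e∈x with e ∈? B
      ... | yes e∈B = ∈-++⁺ˡ e∈B
      ... | no  e∉B = ∈-++⁺ʳ B (∈-filter⁺ ∈x? (∈-filter⁺ (admissible? B)
                        (ordered⇒∈allEdges (∈xEdges⇒ordered e∈x)) (x-admissible part B<n e∈x e∉B)) e∈x)

    -- An admissible edge joins two vertices of degree ≤ 1 in B.
    few-offX : length offX ≤ length (lowVertices B) ℕ.* length (lowVertices B)
    few-offX = ℕ.≤-trans
      (Unique⇒length-≤ (Unique.filter⁺ (∁? ∈x?) (Unique.filter⁺ (admissible? B) allEdges-unique)) offX⊆)
      (ℕ.≤-reflexive (length-cartesianProduct (lowVertices B) (lowVertices B)))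
      where
      allEdges-unique = Unique.filter⁺ ordered? (Unique.cartesianProduct⁺ (Unique.allFin⁺ n) (Unique.allFin⁺ n))
      offX⊆ : offX ⊆ cartesianProduct (lowVertices B) (lowVertices B)
      offX⊆ {i , j} e∈ =
        let e∈cand = proj₁ (∈-filter⁻ (∁? ∈x?) {xs = candidates} e∈)
            i-low , j-low = Admissible⇒low B (i , j) (proj₂ (∈-filter⁻ (admissible? B) {xs = allEdges} e∈cand))
        in ∈-cartesianProduct⁺ (∈-filter⁺ (low? B) (∈-allFin i) i-low) (∈-filter⁺ (low? B) (∈-allFin j) j-low)

    total-weight : Σℚ (map weight candidates) ≡ fromℕ (length onX) * α + fromℕ (length offX) * β
    total-weight = trans (Σℚ-partition weight ∈x? candidates) (cong₂ _+_
      (Σℚ-const weight α onX λ e∈ → weight-x (proj₂ (∈-filter⁻ ∈x? {xs = candidates} e∈)))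
      (Σℚ-const weight β offX λ e∈ →
        let e∈cand , e∉x = ∈-filter⁻ (∁? ∈x?) {xs = candidates} e∈
        in weight-¬x (proj₁ (∈-filter⁻ (admissible? B) {xs = allEdges} e∈cand)) e∉x))

    0<total-weight : 0 < length onX → 0ℚ <ℚ Σℚ (map weight candidates)
    0<total-weight 0<a = subst (0ℚ <ℚ_) (sym total-weight) (ℚ.<-≤-trans 0<aα
      (subst (_≤ℚ fromℕ a * α + fromℕ b * β) (ℚ.+-identityʳ _) (ℚ.+-monoʳ-≤ (fromℕ a * α) (0≤* (0≤fromℕ b) 0≤β))))
      where
      a = length onX
      b = length offX
      0<aα = 0<* (ℚ.<-≤-trans (0<fromℕ 0) (fromℕ-mono-≤ 0<a)) 0<α

  -- Restricting the sum defining P (suc m) B to edges of x: each of the a ≥ m + 1 candidates on x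
  -- is chosen with probability α / W, where W = a α + b β sums the weights of all b + a candidates.
  x-extension-step : ∀ m B → PartOfX B → length B ℕ.+ suc m ≡ n → ∀ u v u′ v′ →
    (∀ a b → suc m ≤ a → b ≤ 2 ℕ.* suc m ℕ.* (2 ℕ.* suc m) → b ≤ n ℕ.* n →
       u′ ℕ.* suc v ℕ.* (D ℕ.* a ℕ.+ b) ≤ D ℕ.* a ℕ.* u ℕ.* suc v′) →
    (∀ e → e ∈ xEdges → e ∉ B → u /1+ v ≤ℚ P m (e ∷ B)) →
    u′ /1+ v′ ≤ℚ P (suc m) B
  x-extension-step m B part B+m≡n u v u′ v′ cross extensions with ham? B
  ... | yes ham = ⊥-elim (PartOfX-incomplete⇒¬ham part (subst (length B <_) B+m≡n (ℕ.m<m+n (length B) (s≤s z≤n))) ham)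
  ... | no  _   = begin
    u′ /1+ v′                              ≤⟨ choice-ratio a b D u v u′ v′ 0<α 0≤β (0<fromℕ (k ℕ.+ suc k ℕ.* suc k))
                                                (ℚ.≤-reflexive D*β≡α) 0≤c (trans (cong (_* c) (sym total-weight)) (*-divℚ-inverse W 0<W))
                                                (cross a b a≥ b≤ b≤′) ⟩
    fromℕ a * α * c * G                    ≡⟨ ℚ.*-assoc (fromℕ a * α) c G ⟩
    fromℕ a * α * (c * G)                  ≡⟨ cong (_* (c * G)) (Σℚ-const weight α onX (weight-x ∘ onX⇒x)) ⟨
    Σℚ (map weight onX) * (c * G)          ≡⟨ Σℚ-*ʳ weight (c * G) onX ⟨
    Σℚ (map (λ e → weight e * (c * G)) onX) ≤⟨ Σℚ-mono-≤ _ f onX term ⟩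
    Σℚ (map f onX)                         ≡⟨ ℚ.+-identityʳ _ ⟨
    Σℚ (map f onX) + 0ℚ                    ≤⟨ ℚ.+-monoʳ-≤ (Σℚ (map f onX)) (0≤Σℚ f offX λ {e} _ → 0≤f e) ⟩
    Σℚ (map f onX) + Σℚ (map f offX)       ≡⟨ Σℚ-partition f ∈x? candidates ⟨
    Σℚ (map f candidates)                  ∎
    where
    open ≤-Reasoning
    open Candidates B part
    a = length onX
    b = length offX
    W = Σℚ (map weight candidates)
    c = divℚ 1ℚ W
    G = u /1+ v
    f : Edge n → ℚ
    f e = divℚ (weight e) W * P m (e ∷ B)
    a≥ : suc m ≤ a
    a≥ = many-onX m B+m≡n
    b≤ : b ≤ 2 ℕ.* suc m ℕ.* (2 ℕ.* suc m)
    b≤ = ℕ.≤-trans few-offX (ℕ.*-mono-≤ low≤ low≤)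
      where low≤ = length-lowVertices part (suc m) B+m≡n
    b≤′ : b ≤ n ℕ.* n
    b≤′ = ℕ.≤-trans few-offX (ℕ.*-mono-≤ (length-lowVertices≤n B) (length-lowVertices≤n B))
    onX⇒x : ∀ {e} → e ∈ onX → e ∈ xEdges
    onX⇒x e∈ = proj₂ (∈-filter⁻ ∈x? {xs = candidates} e∈)
    0<W : 0ℚ <ℚ W
    0<W = 0<total-weight (ℕ.≤-trans (s≤s z≤n) a≥)
    0≤c : 0ℚ ≤ℚ c
    0≤c = 0≤divℚ 1ℚ W (ℚ.nonNegative⁻¹ 1ℚ) (ℚ.<⇒≤ 0<W)
    0≤f : ∀ e → 0ℚ ≤ℚ f e
    0≤f e = 0≤* (0≤divℚ (weight e) W (0≤weight e) (ℚ.<⇒≤ 0<W)) (0≤P m (e ∷ B))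
    term : ∀ {e} → e ∈ onX → weight e * (c * G) ≤ℚ f e
    term {e} e∈ = begin
      weight e * (c * G)      ≡⟨ ℚ.*-assoc (weight e) c G ⟨
      weight e * c * G        ≤⟨ *-monoˡ-≤-0≤ (0≤* (0≤weight e) 0≤c) (extensions e (onX⇒x e∈) e∉B) ⟩
      weight e * c * P m (e ∷ B) ≡⟨ cong (_* P m (e ∷ B)) (divℚ-nonZero (weight e) W 0<W) ⟨
      f e                     ∎
      where
      e∉B = proj₁ (proj₂ (∈-filter⁻ (admissible? B) {xs = allEdges} (proj₁ (∈-filter⁻ ∈x? {xs = candidates} e∈))))

  -- Phase 1 (j ≤ G + 1 edges missing): b ≤ (2 j)², and P j B ≥ (G + 1) / (G + j + 1).
  -- Phase 2 (i + 2 edges missing): b ≤ n² ≤ 2 D, so a step costs at most a factor (i + 1) / (i + 3);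
  -- these telescope to P (i + 2) B ≥ G (G + 1) / (2 (i + 1) (i + 2)).
  module Phases (g : ℕ) (room : 4 ℕ.* suc (suc g) ℕ.* suc (suc g ℕ.+ suc g) ≤ D) (n²≤2D : n ℕ.* n ≤ 2 ℕ.* D) where

    open PhaseInequalities

    G : ℕ
    G = suc g

    phase₁ : ∀ j → j ≤ suc G → ∀ B → PartOfX B → length B ℕ.+ j ≡ n → suc G /1+ (G ℕ.+ j) ≤ℚ P j B
    phase₁ zero _ B part B+0≡n =
      ℚ.≤-trans (/1+-mono-≤ (suc G) (G ℕ.+ 0) 1 0 (ℕ.≤-reflexive (identity G)))
                (complete-success B part (trans (sym (ℕ.+-identityʳ (length B))) B+0≡n))
      where
      identity : ∀ x → suc x ℕ.* 1 ≡ 1 ℕ.* suc (x ℕ.+ 0)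
      identity = solve-∀
    phase₁ (suc j) 1+j≤1+G B part B+1+j≡n =
      x-extension-step j B part B+1+j≡n (suc G) (G ℕ.+ j) (suc G) (G ℕ.+ suc j)
        (λ a b a≥ b≤ _ → phase₁-step G j D a b a≥ b≤ room′)
        (λ e e∈x e∉B → phase₁ j (ℕ.≤-trans j≤G (ℕ.n≤1+n G)) (e ∷ B) (PartOfX-∷ part e∈x e∉B)
                         (trans (sym (ℕ.+-suc (length B) j)) B+1+j≡n))
      where
      j≤G = ℕ.s≤s⁻¹ 1+j≤1+G
      room′ : 4 ℕ.* suc j ℕ.* suc (G ℕ.+ j) ≤ D
      room′ = ℕ.≤-trans (ℕ.*-mono-≤ (ℕ.*-monoʳ-≤ 4 1+j≤1+G) (s≤s (ℕ.+-monoʳ-≤ G j≤G))) room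

    H : ℕ
    H = suc G ℕ.* G

    phase₂ : ∀ i → g ≤ i → ∀ B → PartOfX B → length B ℕ.+ suc (suc i) ≡ n → H /1+ τ i ≤ℚ P (suc (suc i)) B
    phase₂ i g≤i B part B+2+i≡n with g ℕ.≟ i
    ... | yes refl = ℚ.≤-trans (/1+-mono-≤ H (τ g) (suc G) (G ℕ.+ suc G) (ℕ.≤-reflexive (phase₁-end≡phase₂-start g)))
                               (phase₁ (suc G) ℕ.≤-refl B part B+2+i≡n)
    phase₂ zero    g≤0   B part B+2≡n     | no g≢0 = ⊥-elim (g≢0 (ℕ.n≤0⇒n≡0 g≤0))
    phase₂ (suc i) g≤1+i B part B+3+i≡n | no g≢1+i =
      x-extension-step (suc (suc i)) B part B+3+i≡n H (τ i) H (τ (suc i))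
        (λ a b a≥ _ b≤ → phase₂-step H i D a b (n ℕ.* n) a≥ b≤ n²≤2D)
        (λ e e∈x e∉B → phase₂ i (ℕ.s≤s⁻¹ (ℕ.≤∧≢⇒< g≤1+i g≢1+i)) (e ∷ B) (PartOfX-∷ part e∈x e∉B)
                         (trans (sym (ℕ.+-suc (length B) (suc (suc i)))) B+3+i≡n))

  successProb-bound : 8 ≤ k → 1 /1+ 63 ≤ℚ successProb σ d
  successProb-bound 8≤k with PhaseInequalities.quarter k 8≤k
  ... | g , 4[g+2]≤k , k≤3+4[g+2] =
    ℚ.≤-trans (/1+-mono-≤ 1 63 H (τ (suc k)) (final-constant g k k≤3+4[g+2]))
              (phase₂ (suc k) 1+g≤1+k [] ([] , λ ()) refl)
    where
    open PhaseInequalities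
    1+g≤1+k : suc g ≤ suc k
    1+g≤1+k = ℕ.≤-trans (ℕ.n≤1+n (suc g)) (ℕ.≤-trans (ℕ.m≤n*m (suc (suc g)) 4) (ℕ.≤-trans 4[g+2]≤k (ℕ.n≤1+n k)))
    open Phases (suc g) (phase₁-room g k 4[g+2]≤k)
                (n²≤2[n-1][n-2] k (ℕ.≤-trans (s≤s (s≤s (s≤s z≤n))) 8≤k))

open import Defs
open import Data.Nat using (ℕ; _≤_)
open import Data.Fin using (Fin)
open import Data.Fin.Permutation using (Permutation′)
open import Data.List using (List)
open import Data.Rational using (ℚ; 0ℚ; _<_) renaming (_≤_ to _≤ℚ_)
open import Data.Product using (Σ; _×_)
open import Relation.Nullary using (Dec)
open import Relation.Binary.PropositionalEquality using (_≡_)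

open import Data.Nat using (s≤s)
open import Data.Product using (_,_)
open import Data.Rational.Properties using (positive⁻¹)
open RationalArithmetic using (_/1+_)

claim5 : Σ ℚ λ c → (0ℚ < c) × Σ ℕ λ N →
    (n : ℕ) → N ≤ n → 3 ≤ n →
    (cyc? : (G : List (Edge n)) → Dec (HasCycle G)) →
    (ham? : (G : List (Edge n)) → Dec (IsHamCycle G)) →
    (d : Fin n → Fin n → ℚ) → (∀ i j → d i j ≡ d j i) →
    (σ : Permutation′ n) →
    c ≤ℚ Generation.successProb n cyc? ham? σ d
claim5 = 1 /1+ 63 , positive⁻¹ (1 /1+ 63) , 11 , λ where
  (suc (suc (suc k))) (s≤s (s≤s (s≤s 8≤k))) _ cyc? ham? d d-sym σ →
    SuccessProbability.successProb-bound k cyc? ham? σ d d-sym 8≤k
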